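{- Fix a positive integer $k$ and let $G_k(x,y,z)=\sum_{n\ge1}\sum_{m,\ell}p_{n,m,\ell}x^my^\ell z^n$ (as a formal power series). Then $$G_k(x,y,z)=\frac{xz-xz^2+xyz^{k+3}-xyz^{2k+3}}{1-2z+z^2-(x+y)z^{2k+2}+(x+y)z^{2k+3}-xyz^{2k+4}+xyz^{4k+4}}.$$
   Context: The $k$-Skipponacci numbers: $S^{(k)}_n=0$ for $n\le0$, $S^{(k)}_i=i$ for $1\le i\le k+1$, $S^{(k)}_{n+1}=S^{(k)}_n+S^{(k)}_{n-k}$ for $n\ge k+1$. Every integer has a unique far-difference representation $x=\sum_t\epsilon_tS^{(k)}_{n_t}$ ($\epsilon_t\in\{\pm1\}$, distinct indices $n_t\ge1$) with same-sign terms at least $2k+2$ apart in index and opposite-sign terms at least $k+2$ apart. $R_k(n)=S^{(k)}_n+S^{(k)}_{n-2k-2}+S^{(k)}_{n-4k-4}+\cdots$ (positive indices only) for $n>0$, $R_k(n)=0$ for $n\le0$. For $n\ge1$, $p_{n,m,\ell}$ is the number of integers in $(R_k(n-1),R_k(n)]$ whose far-difference representation has exactly $m$ positive and exactly $\ell$ negative summands; $p_{n,m,\ell}=0$ for $n\le0$. -}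

module Defs where

open import Data.Bool using (Bool; true; false; if_then_else_)
open import Data.Nat as ℕ using (ℕ; zero; suc; _∸_)
open import Data.Integer as ℤ using (ℤ; +_)
open import Data.Product using (Σ; _×_; _,_; proj₂)
open import Data.List using (List; []; _∷_; map; length; foldr; upTo)
open import Data.List.Relation.Unary.All using (All)
open import Data.List.Relation.Unary.AllPairs using (AllPairs)
open import Data.List.Relation.Unary.Unique.Propositional using (Unique)
open import Data.List.Membership.Propositional using (_∈_)
open import Relation.Binary.PropositionalEquality using (_≡_; _≢_)

-- k-Skipponacci numbers S^(k)_n  (S^(k)_0 = 0; negative indices never occur)
-- S_i = i for 1 ≤ i ≤ k+1,  S_{n+1} = S_n + S_{n-k} for n ≥ k+1.
-- Defined with a fuel argument (fuel ≥ index suffices).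

SkipF : ℕ → ℕ → ℕ → ℕ
SkipF k zero    n       = 0
SkipF k (suc f) zero    = 0
SkipF k (suc f) (suc n) =
  if n ℕ.≤ᵇ k then suc n else SkipF k f n ℕ.+ SkipF k f (n ∸ k)

Skip : ℕ → ℕ → ℕ
Skip k n = SkipF k n n

-- R_k(n) = S_n + S_{n-2k-2} + S_{n-4k-4} + ... (positive indices), R_k(0) = 0

RF : ℕ → ℕ → ℕ → ℕ
RF k zero    n       = 0
RF k (suc f) zero    = 0
RF k (suc f) (suc n) = Skip k (suc n) ℕ.+ RF k f (suc n ∸ (2 ℕ.* k ℕ.+ 2))

R : ℕ → ℕ → ℕ
R k n = RF k n n

-- A summand is (sign , index); sign true = +S_index, false = -S_index.
-- A representation is listed in decreasing order of indices; every pair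
-- (earlier, later) satisfies the gap condition (which forces strictly
-- decreasing, hence distinct, indices).

Term : Set
Term = Bool × ℕ

Gap : ℕ → Term → Term → Set
Gap k (s , i) (t , j) =
  (s ≡ t → j ℕ.+ (2 ℕ.* k ℕ.+ 2) ℕ.≤ i) × (s ≢ t → j ℕ.+ (k ℕ.+ 2) ℕ.≤ i)

FarDiff : ℕ → List Term → Set
FarDiff k L = All (λ t → 1 ℕ.≤ proj₂ t) L × AllPairs (Gap k) L

sumℤ : List ℤ → ℤ
sumℤ = foldr ℤ._+_ (+ 0)

termValue : ℕ → Term → ℤ
termValue k (true  , i) = + Skip k i
termValue k (false , i) = ℤ.- (+ Skip k i)

value : ℕ → List Term → ℤ
value k L = sumℤ (map (termValue k) L)

npos : List Term → ℕ
npos []                = 0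
npos ((true  , _) ∷ L) = suc (npos L)
npos ((false , _) ∷ L) = npos L

nneg : List Term → ℕ
nneg []                = 0
nneg ((true  , _) ∷ L) = nneg L
nneg ((false , _) ∷ L) = suc (nneg L)

-- x's far-difference representation has exactly m positive and ℓ negative
-- summands (the representation is unique, so "some" = "the").
HasRep : ℕ → ℕ → ℕ → ℤ → Set
HasRep k m ℓ x =
  Σ (List Term) λ L → FarDiff k L × value k L ≡ x × npos L ≡ m × nneg L ≡ ℓ

InBlock : ℕ → ℕ → ℤ → Set
InBlock k n x = (+ R k (n ∸ 1)) ℤ.< x × x ℤ.≤ (+ R k n)

IsCount : (ℤ → Set) → ℕ → Set
IsCount P c =
  Σ (List ℤ) λ L → Unique L × (∀ x → (x ∈ L → P x) × (P x → x ∈ L)) × length L ≡ c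

-- Formal power series in x, y, z over ℤ: f a b c = coefficient of x^a y^b z^c.

Series : Set
Series = ℕ → ℕ → ℕ → ℤ

sumTo : ℕ → (ℕ → ℤ) → ℤ
sumTo n f = sumℤ (map f (upTo (suc n)))

infixl 7 _⊛_
infixl 6 _⊕_

_⊛_ : Series → Series → Series
(f ⊛ g) a b c =
  sumTo a λ i → sumTo b λ j → sumTo c λ l →
    f i j l ℤ.* g (a ∸ i) (b ∸ j) (c ∸ l)

_⊕_ : Series → Series → Series
(f ⊕ g) a b c = f a b c ℤ.+ g a b c

mono : ℤ → ℕ → ℕ → ℕ → Series
mono coef i j l a b c =
  if (a ℕ.≡ᵇ i) then (if (b ℕ.≡ᵇ j) then (if (c ℕ.≡ᵇ l) then coef else + 0) else + 0) else + 0

Den : ℕ → Series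
Den k =
  mono (+ 1) 0 0 0 ⊕ mono (ℤ.- + 2) 0 0 1 ⊕ mono (+ 1) 0 0 2
  ⊕ mono (ℤ.- + 1) 1 0 (2 ℕ.* k ℕ.+ 2) ⊕ mono (ℤ.- + 1) 0 1 (2 ℕ.* k ℕ.+ 2)
  ⊕ mono (+ 1) 1 0 (2 ℕ.* k ℕ.+ 3) ⊕ mono (+ 1) 0 1 (2 ℕ.* k ℕ.+ 3)
  ⊕ mono (ℤ.- + 1) 1 1 (2 ℕ.* k ℕ.+ 4) ⊕ mono (+ 1) 1 1 (4 ℕ.* k ℕ.+ 4)

Num : ℕ → Series
Num k =
  mono (+ 1) 1 0 1 ⊕ mono (ℤ.- + 1) 1 0 2
  ⊕ mono (+ 1) 1 1 (k ℕ.+ 3) ⊕ mono (ℤ.- + 1) 1 1 (2 ℕ.* k ℕ.+ 3)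

GenFun : (ℕ → ℕ → ℕ → ℕ) → Series
GenFun p m ℓ zero    = + 0
GenFun p m ℓ (suc n) = + p (suc n) m ℓ

module Submission where

-- Let p(n,m,ℓ) count the integers of the block (R(n−1), R(n)] whose
-- representation has m positive and ℓ negative summands.  Every such
-- integer x has leading summand +S_n, and removing it leaves either nothing
-- (x = S_n), a representation of x − S_n lying in (0, R(n−2k−2)], or the
-- negation of a representation of S_n − x lying in (0, R(n−k−2)]; the last
-- case swaps the roles of m and ℓ.  Hence, for n ≥ 1,
--   p(n,m+1,ℓ) = [m=ℓ=0] + Σ_{j≤n−2k−2} p(j,m,ℓ) + Σ_{j≤n−k−2} p(j,ℓ,m),
-- i.e. (1 − z − x z^{2k+2}) G(x,y,z) = xz + x z^{k+2} G(y,x,z).  Applying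
-- this recursion at four shifted positions eliminates the swapped series
-- G(y,x,z), which is exactly the statement Den · G = Num.

open import Defs
open import Data.Bool using (Bool; true; false; if_then_else_; T; not)
import Data.Bool.Properties as BoolP
open import Data.Empty using (⊥; ⊥-elim)
open import Data.Unit using (tt)
open import Data.Nat as ℕ using (ℕ; zero; suc; _∸_; _+_; _*_; _≤_; _<_; z≤n; s≤s; s≤s⁻¹; _≤ᵇ_; _≡ᵇ_)
open import Data.Nat.Properties
open import Data.Nat.Induction using (<-rec)
open import Data.Nat.Tactic.RingSolver using (solve-∀)
open import Data.Integer as ℤ using (ℤ; -[1+_]; +≤+; +<+) renaming (+_ to ⁺_)
import Data.Integer.Properties as ℤP
import Data.Integer.Tactic.RingSolver as ℤ-Solver
open import Data.Product using (Σ; _×_; _,_; proj₁; proj₂)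
open import Data.Sum using (_⊎_; inj₁; inj₂; [_,_])
open import Data.List using (List; []; _∷_; map; _++_; applyUpTo; foldl)
open import Data.List.Properties using (length-map; length-++)
open import Data.List.Membership.Propositional using (_∈_)
open import Data.List.Membership.Propositional.Properties using (∈-map⁺; ∈-map⁻; ∈-++⁺ˡ; ∈-++⁺ʳ; ∈-++⁻)
open import Data.List.Membership.Propositional.Properties.WithK using (unique∧set⇒bag)
open import Data.List.Relation.Binary.BagAndSetEquality using (∼bag⇒↭)
open import Data.List.Relation.Binary.Permutation.Propositional.Properties using (↭-length)
open import Data.List.Relation.Unary.Any using (here; there)
open import Data.List.Relation.Unary.All using (All; []; _∷_)
import Data.List.Relation.Unary.All as All
import Data.List.Relation.Unary.All.Properties as All
open import Data.List.Relation.Unary.AllPairs using (AllPairs; []; _∷_)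
import Data.List.Relation.Unary.AllPairs as AllPairs
import Data.List.Relation.Unary.AllPairs.Properties as AllPairs
import Data.List.Relation.Unary.Unique.Propositional.Properties as Unique
open import Function.Base using (_∘_; _∘′_)
open import Function.Bundles using (Equivalence; mk⇔)
open import Relation.Binary.Definitions using (Tri; tri<; tri≈; tri>)
open import Relation.Binary.PropositionalEquality hiding ([_])
open import Relation.Nullary using (¬_; Dec; yes; no)

-- A count is determined by the predicate: two duplicate-free lists with the
-- same members are permutations of each other, hence have equal length.
count-unique : ∀ {P : ℤ → Set} {c c′} → IsCount P c → IsCount P c′ → c ≡ c′
count-unique (L , uniqL , memL , refl) (M , uniqM , memM , refl) =
  ↭-length (∼bag⇒↭ (unique∧set⇒bag uniqL uniqM (mk⇔ L⊆M M⊆L)))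
  where
    L⊆M : ∀ {x} → x ∈ L → x ∈ M
    L⊆M x∈L = proj₂ (memM _) (proj₁ (memL _) x∈L)
    M⊆L : ∀ {x} → x ∈ M → x ∈ L
    M⊆L x∈M = proj₂ (memL _) (proj₁ (memM _) x∈M)

count-cong : ∀ {P Q : ℤ → Set} {c} → IsCount P c
  → (∀ x → P x → Q x) → (∀ x → Q x → P x) → IsCount Q c
count-cong (L , uniq , mem , len) P⇒Q Q⇒P =
  L , uniq , (λ x → (λ x∈L → P⇒Q x (proj₁ (mem x) x∈L)) , (λ q → proj₂ (mem x) (Q⇒P x q))) , len

count-none : ∀ {P : ℤ → Set} → (∀ x → ¬ P x) → IsCount P 0
count-none ¬P = [] , [] , (λ x → (λ ()) , (λ p → ⊥-elim (¬P x p))) , refl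

count-single : ∀ v → IsCount (_≡ v) 1
count-single v = v ∷ [] , [] ∷ [] , (λ x → (λ { (here e) → e ; (there ()) }) , here) , refl

count-union : ∀ {P Q : ℤ → Set} {a b} → IsCount P a → IsCount Q b
  → (∀ x → P x → Q x → ⊥) → IsCount (λ x → P x ⊎ Q x) (a + b)
count-union (L , uniqL , memL , refl) (M , uniqM , memM , refl) disjoint =
  L ++ M ,
  Unique.++⁺ uniqL uniqM (λ { (x∈L , x∈M) → disjoint _ (proj₁ (memL _) x∈L) (proj₁ (memM _) x∈M) }) ,
  (λ x → [ (λ x∈L → inj₁ (proj₁ (memL x) x∈L)) , (λ x∈M → inj₂ (proj₁ (memM x) x∈M)) ] ∘′ ∈-++⁻ L ,
         [ (λ p → ∈-++⁺ˡ (proj₂ (memL x) p)) , (λ q → ∈-++⁺ʳ L (proj₂ (memM x) q)) ]) ,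
  length-++ L

count-bijection : ∀ {P : ℤ → Set} {c} (g h : ℤ → ℤ)
  → (∀ x → g (h x) ≡ x) → (∀ x → h (g x) ≡ x)
  → IsCount P c → IsCount (λ x → P (g x)) c
count-bijection {P} g h gh hg (L , uniq , mem , len) =
  map h L ,
  Unique.map⁺ (λ {x} {y} hx≡hy → trans (sym (gh x)) (trans (cong g hx≡hy) (gh y))) uniq ,
  (λ x → (λ x∈hL → fromImage x (∈-map⁻ h x∈hL)) ,
         (λ p → subst (_∈ map h L) (hg x) (∈-map⁺ h (proj₂ (mem (g x)) p)))) ,
  trans (length-map h L) len
  where
    fromImage : ∀ x → Σ ℤ (λ y → y ∈ L × x ≡ h y) → P (g x)
    fromImage x (y , y∈L , refl) = subst P (sym (gh y)) (proj₁ (mem y) y∈L)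

-- (2) Skipponacci numbers.  Index gaps required between same-sign and
-- opposite-sign summands of a far-difference representation.
sameGap oppGap : ℕ → ℕ
sameGap k = 2 * k + 2
oppGap k = k + 2

1≤sameGap : ∀ k → 1 ≤ sameGap k
1≤sameGap k = ≤-trans (s≤s z≤n) (m≤n+m 2 (2 * k))

1≤oppGap : ∀ k → 1 ≤ oppGap k
1≤oppGap k = ≤-trans (s≤s z≤n) (m≤n+m 2 k)

module Skipponacci (k : ℕ) where

  -- Skip and R are computed with a fuel argument; any fuel at least the
  -- index gives the same value, which lets us unfold the recursions.
  -- S_{n+1} = n+1 if n ≤ k, and S_n + S_{n−k} otherwise.
  SkipF-fuel : ∀ f g x → x ≤ f → x ≤ g → SkipF k f x ≡ SkipF k g x
  SkipF-fuel zero    zero    zero    _       _       = refl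
  SkipF-fuel zero    (suc g) zero    _       _       = refl
  SkipF-fuel (suc f) zero    zero    _       _       = refl
  SkipF-fuel (suc f) (suc g) zero    _       _       = refl
  SkipF-fuel (suc f) (suc g) (suc x) (s≤s x≤f) (s≤s x≤g) =
    cong (if x ≤ᵇ k then suc x else_)
      (cong₂ _+_ (SkipF-fuel f g x x≤f x≤g)
                 (SkipF-fuel f g (x ∸ k) (≤-trans (m∸n≤m x k) x≤f) (≤-trans (m∸n≤m x k) x≤g)))

  Skip-unfold : ∀ n → Skip k (suc n) ≡ (if n ≤ᵇ k then suc n else Skip k n + Skip k (n ∸ k))
  Skip-unfold n = cong (λ s → if n ≤ᵇ k then suc n else Skip k n + s)
                    (SkipF-fuel n (n ∸ k) (n ∸ k) (m∸n≤m n k) ≤-refl)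

  Skip-initial : ∀ n → n ≤ k → Skip k (suc n) ≡ suc n
  Skip-initial n n≤k rewrite Skip-unfold n with n ≤ᵇ k | ≤⇒≤ᵇ n≤k
  ... | true | _ = refl

  Skip-recurrence : ∀ n → k < n → Skip k (suc n) ≡ Skip k n + Skip k (n ∸ k)
  Skip-recurrence n k<n rewrite Skip-unfold n with n ≤ᵇ k in n≤ᵇk
  ... | false = refl
  ... | true  = ⊥-elim (<⇒≱ k<n (≤ᵇ⇒≤ n k (subst T (sym n≤ᵇk) tt)))

  suc∸sameGap≤ : ∀ n → suc n ∸ sameGap k ≤ n
  suc∸sameGap≤ n rewrite +-comm (2 * k) 2 = m∸n≤m n (suc (2 * k))

  RF-fuel : ∀ f g x → x ≤ f → x ≤ g → RF k f x ≡ RF k g x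
  RF-fuel zero    zero    zero    _       _       = refl
  RF-fuel zero    (suc g) zero    _       _       = refl
  RF-fuel (suc f) zero    zero    _       _       = refl
  RF-fuel (suc f) (suc g) zero    _       _       = refl
  RF-fuel (suc f) (suc g) (suc x) (s≤s x≤f) (s≤s x≤g) =
    cong (Skip k (suc x) +_)
      (RF-fuel f g (suc x ∸ sameGap k) (≤-trans (suc∸sameGap≤ x) x≤f) (≤-trans (suc∸sameGap≤ x) x≤g))

  R-unfold : ∀ n → R k (suc n) ≡ Skip k (suc n) + R k (suc n ∸ sameGap k)
  R-unfold n = cong (Skip k (suc n) +_) (RF-fuel n _ _ (suc∸sameGap≤ n) ≤-refl)

  R-initial : ∀ n → n ≤ k → R k n ≡ n
  R-initial zero    _       = refl
  R-initial (suc n) 1+n≤k = begin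
    R k (suc n)                                   ≡⟨ R-unfold n ⟩
    Skip k (suc n) + R k (suc n ∸ sameGap k)      ≡⟨ cong₂ _+_ (Skip-initial n (≤-trans (n≤1+n n) 1+n≤k))
                                                              (cong (R k) (m≤n⇒m∸n≡0 1+n≤2k+2)) ⟩
    suc n + 0                                     ≡⟨ +-identityʳ (suc n) ⟩
    suc n                                         ∎
    where
      open ≡-Reasoning
      1+n≤2k+2 : suc n ≤ sameGap k
      1+n≤2k+2 = ≤-trans 1+n≤k (≤-trans (m≤m+n k (k + 0)) (m≤m+n _ 2))

  -- The key identity  S_{n+1} = R_k(n) + R_k(n − (k+1)) + 1: the largest
  -- number whose representation lives below index n+1 is one less than S_{n+1}.
  Skip-suc : ∀ n → Skip k (suc n) ≡ suc (R k n + R k (n ∸ suc k))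
  Skip-suc = <-rec _ step
    where
      open ≡-Reasoning
      step : ∀ n → (∀ {m} → m < n → Skip k (suc m) ≡ suc (R k m + R k (m ∸ suc k)))
                 → Skip k (suc n) ≡ suc (R k n + R k (n ∸ suc k))
      step n rec with ≤-<-connex n k
      ... | inj₁ n≤k = begin
        Skip k (suc n)                    ≡⟨ Skip-initial n n≤k ⟩
        suc n                             ≡⟨ cong suc (sym (+-identityʳ n)) ⟩
        suc (n + 0)                       ≡⟨ cong₂ (λ a b → suc (a + b)) (sym (R-initial n n≤k))
                                                   (cong (R k) (sym (m≤n⇒m∸n≡0 (≤-trans n≤k (n≤1+n k))))) ⟩
        suc (R k n + R k (n ∸ suc k))     ∎
      step (suc n) rec | inj₂ k<1+n = begin
        Skip k (suc (suc n))                                ≡⟨ Skip-recurrence (suc n) k<1+n ⟩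
        Skip k (suc n) + Skip k (suc n ∸ k)                 ≡⟨ cong (λ i → Skip k (suc n) + Skip k i) (+-∸-assoc 1 (s≤s⁻¹ k<1+n)) ⟩
        Skip k (suc n) + Skip k (suc m)                     ≡⟨ cong (Skip k (suc n) +_) (rec (s≤s (m∸n≤m n k))) ⟩
        Skip k (suc n) + suc (R k m + R k (m ∸ suc k))      ≡⟨ cong (λ i → Skip k (suc n) + suc (R k m + R k i)) m∸k+1 ⟩
        Skip k (suc n) + suc (R k m + R k (suc n ∸ sameGap k)) ≡⟨ regroup (Skip k (suc n)) (R k m) _ ⟩
        suc (Skip k (suc n) + R k (suc n ∸ sameGap k) + R k m) ≡⟨ cong (λ r → suc (r + R k m)) (sym (R-unfold n)) ⟩
        suc (R k (suc n) + R k m)                           ∎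
        where
          m : ℕ
          m = n ∸ k
          gap : ∀ k → suc (k + suc k) ≡ 2 * k + 2
          gap = solve-∀
          m∸k+1 : m ∸ suc k ≡ suc n ∸ sameGap k
          m∸k+1 = trans (∸-+-assoc n k (suc k)) (cong (suc n ∸_) (gap k))
          regroup : ∀ a b c → a + suc (b + c) ≡ suc (a + c + b)
          regroup = solve-∀

  R<Skip-suc : ∀ n → R k n < Skip k (suc n)
  R<Skip-suc n rewrite Skip-suc n = s≤s (m≤m+n _ _)

  Skip≤R : ∀ n → Skip k n ≤ R k n
  Skip≤R zero    = z≤n
  Skip≤R (suc n) rewrite R-unfold n = m≤m+n _ _

  R-strictlyIncreasing : ∀ n → R k n < R k (suc n)
  R-strictlyIncreasing n = <-≤-trans (R<Skip-suc n) (Skip≤R (suc n))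

  R-mono : ∀ {i j} → i ≤ j → R k i ≤ R k j
  R-mono {i} {j} i≤j with m≤n⇒m<n∨m≡n i≤j
  ... | inj₂ refl = ≤-refl
  R-mono {i} {suc j} _ | inj₁ (s≤s i≤j) = ≤-trans (R-mono i≤j) (<⇒≤ (R-strictlyIncreasing j))

module Representations (k : ℕ) where
  open Skipponacci k

  InRange : ℕ → ℤ → Set
  InRange N v = ⁺ 0 ℤ.< v × v ℤ.≤ ⁺ R k N

  range-zero : ∀ {v} → ¬ InRange 0 v
  range-zero (0<v , v≤0) = ℤP.<-irrefl refl (ℤP.<-≤-trans 0<v v≤0)

  range-mono : ∀ {N N′ v} → N ≤ N′ → InRange N v → InRange N′ v
  range-mono N≤N′ (0<v , v≤R) = 0<v , ℤP.≤-trans v≤R (+≤+ (R-mono N≤N′))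

  block⇒range : ∀ {n v} → InBlock k n v → InRange n v
  block⇒range (lo , hi) = ℤP.≤-<-trans (+≤+ z≤n) lo , hi

  block-unique : ∀ {j n x} → InBlock k j x → InBlock k n x → j ≡ n
  block-unique {j} {n} (lo₁ , hi₁) (lo₂ , hi₂) with <-cmp j n
  ... | tri≈ _ j≡n _ = j≡n
  ... | tri< j<n _ _ = ⊥-elim (ℤP.<-irrefl refl (ℤP.≤-<-trans (ℤP.≤-trans hi₁ (+≤+ (R-mono (pred-mono-≤ j<n)))) lo₂))
  ... | tri> _ _ n<j = ⊥-elim (ℤP.<-irrefl refl (ℤP.≤-<-trans (ℤP.≤-trans hi₂ (+≤+ (R-mono (pred-mono-≤ n<j)))) lo₁))

  prepend-same : ∀ n {v} → InRange (n ∸ sameGap k) v → InBlock k n (⁺ Skip k n ℤ.+ v)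
  prepend-same zero {v} r = ⊥-elim (range-zero (subst (λ N → InRange N v) (0∸n≡0 (sameGap k)) r))
  prepend-same (suc n) {v} (0<v , v≤R) = lower , upper
    where
      open ℤP.≤-Reasoning
      S : ℤ
      S = ⁺ Skip k (suc n)
      lower : ⁺ R k n ℤ.< S ℤ.+ v
      lower = begin-strict
        ⁺ R k n   <⟨ +<+ (R<Skip-suc n) ⟩
        S         ≡⟨ sym (ℤP.+-identityʳ S) ⟩
        S ℤ.+ ⁺ 0 ≤⟨ ℤP.+-monoʳ-≤ S (ℤP.<⇒≤ 0<v) ⟩
        S ℤ.+ v   ∎
      upper : S ℤ.+ v ℤ.≤ ⁺ R k (suc n)
      upper = begin
        S ℤ.+ v                          ≤⟨ ℤP.+-monoʳ-≤ S v≤R ⟩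
        S ℤ.+ ⁺ R k (suc n ∸ sameGap k)  ≡⟨ cong ⁺_ (sym (R-unfold n)) ⟩
        ⁺ R k (suc n)                    ∎

  prepend-opp : ∀ n {v} → InRange (n ∸ oppGap k) v → InBlock k n (⁺ Skip k n ℤ.- v)
  prepend-opp zero {v} r = ⊥-elim (range-zero (subst (λ N → InRange N v) (0∸n≡0 (oppGap k)) r))
  prepend-opp (suc n) {v} (0<v , v≤R) = lower , upper
    where
      open ℤP.≤-Reasoning
      S Rb : ℤ
      S  = ⁺ Skip k (suc n)
      Rb = ⁺ R k (n ∸ suc k)
      v≤Rb : v ℤ.≤ Rb
      v≤Rb = subst (λ i → v ℤ.≤ ⁺ R k i) (cong (suc n ∸_) (+-comm k 2)) v≤R
      S-Rb : S ℤ.- Rb ≡ ⁺ suc (R k n)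
      S-Rb = begin-equality
        S ℤ.- Rb                        ≡⟨ cong (λ s → ⁺ s ℤ.- Rb) (Skip-suc n) ⟩
        (⁺ suc (R k n) ℤ.+ Rb) ℤ.- Rb   ≡⟨ cancel (⁺ suc (R k n)) Rb ⟩
        ⁺ suc (R k n)                   ∎
        where
          cancel : ∀ a b → (a ℤ.+ b) ℤ.- b ≡ a
          cancel = ℤ-Solver.solve-∀
      lower : ⁺ R k n ℤ.< S ℤ.- v
      lower = begin-strict
        ⁺ R k n        <⟨ +<+ ≤-refl ⟩
        ⁺ suc (R k n)  ≡⟨ sym S-Rb ⟩
        S ℤ.- Rb       ≤⟨ ℤP.+-monoʳ-≤ S (ℤP.neg-mono-≤ v≤Rb) ⟩
        S ℤ.- v        ∎
      upper : S ℤ.- v ℤ.≤ ⁺ R k (suc n)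
      upper = begin
        S ℤ.- v        ≤⟨ ℤP.+-monoʳ-≤ S (ℤP.neg-mono-≤ (ℤP.<⇒≤ 0<v)) ⟩
        S ℤ.+ ⁺ 0      ≡⟨ ℤP.+-identityʳ S ⟩
        S              ≤⟨ +≤+ (Skip≤R (suc n)) ⟩
        ⁺ R k (suc n)  ∎

  flipTerm : Term → Term
  flipTerm (s , i) = not s , i

  flip : List Term → List Term
  flip = map flipTerm

  value-flip : ∀ L → value k (flip L) ≡ ℤ.- value k L
  value-flip []              = refl
  value-flip ((s , i) ∷ L) = begin
    termValue k (not s , i) ℤ.+ value k (flip L)  ≡⟨ cong₂ ℤ._+_ (termValue-flip s) (value-flip L) ⟩
    ℤ.- termValue k (s , i) ℤ.+ ℤ.- value k L     ≡⟨ sym (ℤP.neg-distrib-+ (termValue k (s , i)) (value k L)) ⟩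
    ℤ.- (termValue k (s , i) ℤ.+ value k L)       ∎
    where
      open ≡-Reasoning
      termValue-flip : ∀ s → termValue k (not s , i) ≡ ℤ.- termValue k (s , i)
      termValue-flip true  = refl
      termValue-flip false = sym (ℤP.neg-involutive _)

  npos-flip : ∀ L → npos (flip L) ≡ nneg L
  npos-flip []                = refl
  npos-flip ((true  , _) ∷ L) = npos-flip L
  npos-flip ((false , _) ∷ L) = cong suc (npos-flip L)

  nneg-flip : ∀ L → nneg (flip L) ≡ npos L
  nneg-flip []                = refl
  nneg-flip ((true  , _) ∷ L) = cong suc (nneg-flip L)
  nneg-flip ((false , _) ∷ L) = nneg-flip L

  FarDiff-flip : ∀ L → FarDiff k L → FarDiff k (flip L)
  FarDiff-flip L (positive , gaps) =
    All.map⁺ positive , AllPairs.map⁺ (AllPairs.map (λ {x} {y} → gap-flip x y) gaps)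
    where
      gap-flip : ∀ x y → Gap k x y → Gap k (flipTerm x) (flipTerm y)
      gap-flip (s , _) (t , _) (same , opp) =
        (λ eq → same (BoolP.not-injective eq)) , (λ s≢t → opp (λ eq → s≢t (cong not eq)))

  signed : Bool → ℤ → ℤ
  signed true  v = v
  signed false v = ℤ.- v

  signed-lead : ∀ s n T → signed s (value k ((s , n) ∷ T)) ≡ ⁺ Skip k n ℤ.+ signed s (value k T)
  signed-lead true  n T = refl
  signed-lead false n T = begin
    ℤ.- (ℤ.- ⁺ Skip k n ℤ.+ value k T)         ≡⟨ ℤP.neg-distrib-+ (ℤ.- ⁺ Skip k n) (value k T) ⟩
    ℤ.- ℤ.- ⁺ Skip k n ℤ.+ ℤ.- value k T       ≡⟨ cong (ℤ._+ ℤ.- value k T) (ℤP.neg-involutive (⁺ Skip k n)) ⟩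
    ⁺ Skip k n ℤ.+ ℤ.- value k T               ∎
    where open ≡-Reasoning

  signed-opposite : ∀ {s t} v → s ≢ t → signed s v ≡ ℤ.- signed t v
  signed-opposite {true}  {true}  v s≢t = ⊥-elim (s≢t refl)
  signed-opposite {true}  {false} v _   = sym (ℤP.neg-involutive v)
  signed-opposite {false} {true}  v _   = refl
  signed-opposite {false} {false} v s≢t = ⊥-elim (s≢t refl)

  leading-block : ∀ s n T → FarDiff k ((s , n) ∷ T) → InBlock k n (signed s (value k ((s , n) ∷ T)))
  leading-block s (suc n) [] _ =
    subst (InBlock k (suc n)) (sym (trans (signed-lead s (suc n) []) (emptyTail s)))
      (+<+ (R<Skip-suc n) , +≤+ (Skip≤R (suc n)))
    where
      emptyTail : ∀ s → ⁺ Skip k (suc n) ℤ.+ signed s (⁺ 0) ≡ ⁺ Skip k (suc n)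
      emptyTail true  = ℤP.+-identityʳ _
      emptyTail false = ℤP.+-identityʳ _
  leading-block s n ((t , j) ∷ T) (_ ∷ positive , (gap ∷ _) ∷ gaps) =
    subst (InBlock k n) (sym (signed-lead s n ((t , j) ∷ T))) (prepend (s BoolP.≟ t))
    where
      u : ℤ
      u = signed t (value k ((t , j) ∷ T))
      tailRange : InRange j u
      tailRange = block⇒range {j} (leading-block t j T (positive , gaps))
      prepend : Dec (s ≡ t) → InBlock k n (⁺ Skip k n ℤ.+ signed s (value k ((t , j) ∷ T)))
      prepend (yes refl) = prepend-same n (range-mono (m+n≤o⇒m≤o∸n j (proj₁ gap refl)) tailRange)
      prepend (no s≢t)   = subst (InBlock k n) (cong (ℤ._+_ (⁺ Skip k n)) (sym (signed-opposite _ s≢t)))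
                             (prepend-opp n (range-mono (m+n≤o⇒m≤o∸n j (proj₂ gap s≢t)) tailRange))

  leading-positive : ∀ L → FarDiff k L → ⁺ 0 ℤ.< value k L
    → Σ ℕ λ i → Σ (List Term) λ T → L ≡ (true , i) ∷ T
  leading-positive []                _  (+<+ ())
  leading-positive ((true  , i) ∷ T) _  _   = i , T , refl
  leading-positive ((false , i) ∷ T) fd 0<v =
    ⊥-elim (ℤP.<-asym 0<v (ℤP.neg-cancel-< (proj₁ (block⇒range {i} (leading-block false i T fd)))))

  leading-index : ∀ n L → FarDiff k L → InBlock k n (value k L)
    → Σ (List Term) λ T → L ≡ (true , n) ∷ T
  leading-index n L fd x∈n with leading-positive L fd (proj₁ (block⇒range {n} x∈n))
  ... | i , T , refl = T , cong (λ j → (true , j) ∷ T) (block-unique (leading-block true i T fd) x∈n)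

  leading-range : ∀ N L → FarDiff k L → InRange N (value k L)
    → Σ ℕ λ i → Σ (List Term) λ T → L ≡ (true , i) ∷ T × 1 ≤ i × i ≤ N
  leading-range N L fd (0<v , v≤R) with leading-positive L fd 0<v
  ... | i , T , refl with i ≤? N
  ...   | yes i≤N = i , T , refl , All.head (proj₁ fd) , i≤N
  ...   | no  i≰N = ⊥-elim (ℤP.<-irrefl refl (ℤP.≤-<-trans
                      (ℤP.≤-trans v≤R (+≤+ (R-mono (pred-mono-≤ (≰⇒> i≰N)))))
                      (proj₁ (leading-block true i T fd))))

module Decomposition (k : ℕ) where
  open Skipponacci k
  open Representations k

  BlockRep : ℕ → ℕ → ℕ → ℤ → Set
  BlockRep n m ℓ x = InBlock k n x × HasRep k m ℓ x

  RangeRep : ℕ → ℕ → ℕ → ℤ → Set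
  RangeRep N m ℓ x = InRange N x × HasRep k m ℓ x

  block-no-positive : ∀ n ℓ x → ¬ BlockRep n 0 ℓ x
  block-no-positive n ℓ x (x∈n , L , fd , refl , npos≡0 , _) with leading-index n L fd x∈n
  ... | T , refl with npos≡0
  ... | ()

  Decomposed : ℕ → ℕ → ℕ → ℤ → Set
  Decomposed n m ℓ x =
    (x ≡ ⁺ Skip k n × m ≡ 0 × ℓ ≡ 0)
    ⊎ RangeRep (n ∸ sameGap k) m ℓ (x ℤ.- ⁺ Skip k n)
    ⊎ RangeRep (n ∸ oppGap k) ℓ m (⁺ Skip k n ℤ.- x)

  decompose : ∀ n m ℓ x → BlockRep n (suc m) ℓ x → Decomposed n m ℓ x
  decompose n m ℓ x (x∈n , L , fd , refl , npos≡ , nneg≡) with leading-index n L fd x∈n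
  ... | [] , refl = inj₁ (ℤP.+-identityʳ _ , sym (suc-injective npos≡) , sym nneg≡)
  ... | (true , i) ∷ T , refl =
    inj₂ (inj₁ (subst (RangeRep (n ∸ sameGap k) m ℓ) (sym (add-sub S vT))
      (range-mono (m+n≤o⇒m≤o∸n i (proj₁ gap refl)) (block⇒range {i} (leading-block true i T fdT)) ,
       (true , i) ∷ T , fdT , refl , suc-injective npos≡ , nneg≡)))
    where
      S vT : ℤ
      S  = ⁺ Skip k n
      vT = value k ((true , i) ∷ T)
      fdT : FarDiff k ((true , i) ∷ T)
      fdT = All.tail (proj₁ fd) , AllPairs.tail (proj₂ fd)
      gap : Gap k (true , n) (true , i)
      gap = All.head (AllPairs.head (proj₂ fd))
      add-sub : ∀ a b → (a ℤ.+ b) ℤ.- a ≡ b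
      add-sub = ℤ-Solver.solve-∀
  ... | (false , i) ∷ T , refl =
    inj₂ (inj₂ (subst (InRange (n ∸ oppGap k)) (sym (sub-add S vT))
      (range-mono (m+n≤o⇒m≤o∸n i (proj₂ gap (λ ()))) (block⇒range {i} (leading-block false i T fdT))) ,
       (flip ((false , i) ∷ T) , FarDiff-flip ((false , i) ∷ T) fdT ,
        trans (value-flip ((false , i) ∷ T)) (sym (sub-add S vT)) ,
        trans (npos-flip ((false , i) ∷ T)) nneg≡ , trans (nneg-flip ((false , i) ∷ T)) (suc-injective npos≡))))
    where
      S vT : ℤ
      S  = ⁺ Skip k n
      vT = value k ((false , i) ∷ T)
      fdT : FarDiff k ((false , i) ∷ T)
      fdT = All.tail (proj₁ fd) , AllPairs.tail (proj₂ fd)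
      gap : Gap k (true , n) (false , i)
      gap = All.head (AllPairs.head (proj₂ fd))
      sub-add : ∀ a b → a ℤ.- (a ℤ.+ b) ≡ ℤ.- b
      sub-add = ℤ-Solver.solve-∀

  gap-raise-same : ∀ {i n} y → Gap k (true , i) y → i + sameGap k ≤ n → Gap k (true , n) y
  gap-raise-same (true , l) (same , _) i+g≤n =
    (λ _ → ≤-trans (same refl) (≤-trans (m≤m+n _ (sameGap k)) i+g≤n)) , (λ t≢t → ⊥-elim (t≢t refl))
  gap-raise-same (false , l) (_ , opp) i+g≤n =
    (λ ()) , (λ _ → ≤-trans (opp (λ ())) (≤-trans (m≤m+n _ (sameGap k)) i+g≤n))

  gap-raise-opp : ∀ {i n} y → Gap k (true , i) y → i + oppGap k ≤ n → Gap k (true , n) (flipTerm y)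
  gap-raise-opp {i} {n} (true , l) (same , _) i+g≤n = (λ ()) , (λ _ → begin
    l + oppGap k    ≤⟨ +-monoʳ-≤ l (m≤n+m (oppGap k) k) ⟩
    l + (k + oppGap k) ≡⟨ cong (l +_) (sym (sameGap≡ k)) ⟩
    l + sameGap k   ≤⟨ same refl ⟩
    i               ≤⟨ ≤-trans (m≤m+n i (oppGap k)) i+g≤n ⟩
    n               ∎)
    where
      open ≤-Reasoning
      sameGap≡ : ∀ k → 2 * k + 2 ≡ k + (k + 2)
      sameGap≡ = solve-∀
  gap-raise-opp {i} {n} (false , l) (_ , opp) i+g≤n = (λ _ → begin
    l + sameGap k           ≤⟨ +-monoʳ-≤ l (m≤n+m (sameGap k) 2) ⟩
    l + (2 + sameGap k)     ≡⟨ regroup l k ⟩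
    (l + oppGap k) + oppGap k ≤⟨ +-monoˡ-≤ (oppGap k) (opp (λ ())) ⟩
    i + oppGap k            ≤⟨ i+g≤n ⟩
    n                       ∎) , (λ f≢f → ⊥-elim (f≢f refl))
    where
      open ≤-Reasoning
      regroup : ∀ l k → l + (2 + (2 * k + 2)) ≡ (l + (k + 2)) + (k + 2)
      regroup = solve-∀

  index-gap : ∀ {i n} g → 1 ≤ i → i ≤ n ∸ g → i + g ≤ n
  index-gap {i} {n} g 1≤i i≤n∸g with ≤-total g n
  ... | inj₁ g≤n = m≤o∸n⇒m+n≤o i g≤n i≤n∸g
  ... | inj₂ n≤g = ⊥-elim (<⇒≱ (≤-trans 1≤i (≤-trans i≤n∸g (≤-reflexive (m≤n⇒m∸n≡0 n≤g)))) z≤n)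

  recompose : ∀ n m ℓ x → 1 ≤ n → Decomposed n m ℓ x → BlockRep n (suc m) ℓ x
  recompose n _ _ x 1≤n (inj₁ (refl , refl , refl)) =
    subst (InBlock k n) (ℤP.+-identityʳ _) (leading-block true n [] fd) ,
    (true , n) ∷ [] , fd , ℤP.+-identityʳ _ , refl , refl
    where
      fd : FarDiff k ((true , n) ∷ [])
      fd = 1≤n ∷ [] , [] ∷ []
  recompose n m ℓ x _ (inj₂ (inj₁ (r , T , fdT , vT≡ , npos≡ , nneg≡)))
    with leading-range (n ∸ sameGap k) T fdT (subst (InRange (n ∸ sameGap k)) (sym vT≡) r)
  ... | i , T′ , refl , 1≤i , i≤ =
    subst (InBlock k n) val (leading-block true n T fd) , (true , n) ∷ T , fd , val , cong suc npos≡ , nneg≡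
    where
      i+g≤n : i + sameGap k ≤ n
      i+g≤n = index-gap (sameGap k) 1≤i i≤
      fd : FarDiff k ((true , n) ∷ T)
      fd = ≤-trans 1≤i (≤-trans (m≤m+n i _) i+g≤n) ∷ proj₁ fdT ,
           (((λ _ → i+g≤n) , (λ t≢t → ⊥-elim (t≢t refl)))
             ∷ All.map (λ {y} g → gap-raise-same y g i+g≤n) (AllPairs.head (proj₂ fdT)))
           ∷ proj₂ fdT
      val : ⁺ Skip k n ℤ.+ value k T ≡ x
      val = trans (cong (ℤ._+_ (⁺ Skip k n)) vT≡) (add-sub (⁺ Skip k n) x)
        where
          add-sub : ∀ a b → a ℤ.+ (b ℤ.- a) ≡ b
          add-sub = ℤ-Solver.solve-∀
  recompose n m ℓ x _ (inj₂ (inj₂ (r , T , fdT , vT≡ , npos≡ , nneg≡)))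
    with leading-range (n ∸ oppGap k) T fdT (subst (InRange (n ∸ oppGap k)) (sym vT≡) r)
  ... | i , T′ , refl , 1≤i , i≤ =
    subst (InBlock k n) val (leading-block true n (flip T) fd) , (true , n) ∷ flip T , fd , val ,
    cong suc (trans (npos-flip T) nneg≡) , trans (nneg-flip T) npos≡
    where
      i+g≤n : i + oppGap k ≤ n
      i+g≤n = index-gap (oppGap k) 1≤i i≤
      fd : FarDiff k ((true , n) ∷ flip T)
      fd = ≤-trans 1≤i (≤-trans (m≤m+n i _) i+g≤n) ∷ proj₁ (FarDiff-flip T fdT) ,
           (((λ ()) , (λ _ → i+g≤n))
             ∷ All.map⁺ (All.map (λ {y} g → gap-raise-opp y g i+g≤n) (AllPairs.head (proj₂ fdT))))
           ∷ proj₂ (FarDiff-flip T fdT)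
      val : ⁺ Skip k n ℤ.+ value k (flip T) ≡ x
      val = trans (cong (ℤ._+_ (⁺ Skip k n)) (trans (value-flip T) (cong ℤ.-_ vT≡))) (sub-sub (⁺ Skip k n) x)
        where
          sub-sub : ∀ a b → a ℤ.- (a ℤ.- b) ≡ b
          sub-sub = ℤ-Solver.solve-∀

cumulative : (ℕ → ℕ → ℕ → ℕ) → ℕ → ℕ → ℕ → ℕ
cumulative p zero    m ℓ = 0
cumulative p (suc N) m ℓ = cumulative p N m ℓ + p (suc N) m ℓ

δ₀₀ : ℕ → ℕ → ℕ
δ₀₀ zero    zero    = 1
δ₀₀ zero    (suc _) = 0
δ₀₀ (suc _) _       = 0

module BlockCounts (k : ℕ) (p : ℕ → ℕ → ℕ → ℕ)
  (p-counts : ∀ n m ℓ → 1 ≤ n → IsCount (λ x → InBlock k n x × HasRep k m ℓ x) (p n m ℓ)) where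
  open Skipponacci k
  open Representations k
  open Decomposition k

  -- (0, R_k(N)] is the disjoint union of the blocks 1, …, N.
  count-range : ∀ N m ℓ → IsCount (RangeRep N m ℓ) (cumulative p N m ℓ)
  count-range zero    m ℓ = count-none (λ x r → range-zero (proj₁ r))
  count-range (suc N) m ℓ =
    count-cong (count-union (count-range N m ℓ) (p-counts (suc N) m ℓ (s≤s z≤n)) disjoint) merge split
    where
      disjoint : ∀ x → RangeRep N m ℓ x → BlockRep (suc N) m ℓ x → ⊥
      disjoint x ((_ , x≤R) , _) ((R<x , _) , _) = ℤP.<-irrefl refl (ℤP.≤-<-trans x≤R R<x)
      merge : ∀ x → RangeRep N m ℓ x ⊎ BlockRep (suc N) m ℓ x → RangeRep (suc N) m ℓ x
      merge x (inj₁ (r , rep)) = range-mono (n≤1+n N) r , rep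
      merge x (inj₂ (b , rep)) = block⇒range {suc N} b , rep
      split : ∀ x → RangeRep (suc N) m ℓ x → RangeRep N m ℓ x ⊎ BlockRep (suc N) m ℓ x
      split x ((0<x , x≤R) , rep) with x ℤP.≤? ⁺ R k N
      ... | yes x≤RN = inj₁ ((0<x , x≤RN) , rep)
      ... | no  x≰RN = inj₂ ((ℤP.≰⇒> x≰RN , x≤R) , rep)

  count-decomposed : ∀ n m ℓ →
    IsCount (Decomposed n m ℓ) (δ₀₀ m ℓ + (cumulative p (n ∸ sameGap k) m ℓ + cumulative p (n ∸ oppGap k) ℓ m))
  count-decomposed n m ℓ =
    count-union (count-leading m ℓ) (count-union countSame countOpp disjointTails) disjointLeading
    where
      S : ℤ
      S = ⁺ Skip k n
      count-leading : ∀ m ℓ → IsCount (λ x → x ≡ S × m ≡ 0 × ℓ ≡ 0) (δ₀₀ m ℓ)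
      count-leading zero    zero    = count-cong (count-single S) (λ x x≡S → x≡S , refl , refl) (λ x → proj₁)
      count-leading zero    (suc ℓ) = count-none (λ { x (_ , _ , ()) })
      count-leading (suc m) ℓ       = count-none (λ { x (_ , () , _) })
      countSame : IsCount (λ x → RangeRep (n ∸ sameGap k) m ℓ (x ℤ.- S)) (cumulative p (n ∸ sameGap k) m ℓ)
      countSame = count-bijection (λ x → x ℤ.- S) (λ y → y ℤ.+ S) (λ y → sub-add y S) (λ x → add-sub x S)
                    (count-range (n ∸ sameGap k) m ℓ)
        where
          sub-add : ∀ y s → (y ℤ.+ s) ℤ.- s ≡ y
          sub-add = ℤ-Solver.solve-∀
          add-sub : ∀ x s → (x ℤ.- s) ℤ.+ s ≡ x
          add-sub = ℤ-Solver.solve-∀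
      countOpp : IsCount (λ x → RangeRep (n ∸ oppGap k) ℓ m (S ℤ.- x)) (cumulative p (n ∸ oppGap k) ℓ m)
      countOpp = count-bijection (λ x → S ℤ.- x) (λ y → S ℤ.- y) (reflect S) (reflect S)
                   (count-range (n ∸ oppGap k) ℓ m)
        where
          reflect : ∀ s x → s ℤ.- (s ℤ.- x) ≡ x
          reflect = ℤ-Solver.solve-∀
      disjointTails : ∀ x → RangeRep (n ∸ sameGap k) m ℓ (x ℤ.- S) → RangeRep (n ∸ oppGap k) ℓ m (S ℤ.- x) → ⊥
      disjointTails x ((0<x-S , _) , _) ((0<S-x , _) , _) =
        ℤP.<-irrefl refl (subst (⁺ 0 ℤ.<_) (cancel x S) (ℤP.+-mono-< 0<x-S 0<S-x))
        where
          cancel : ∀ x s → (x ℤ.- s) ℤ.+ (s ℤ.- x) ≡ ⁺ 0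
          cancel = ℤ-Solver.solve-∀
      disjointLeading : ∀ x → (x ≡ S × m ≡ 0 × ℓ ≡ 0)
        → RangeRep (n ∸ sameGap k) m ℓ (x ℤ.- S) ⊎ RangeRep (n ∸ oppGap k) ℓ m (S ℤ.- x) → ⊥
      disjointLeading x (refl , _) (inj₁ ((0<0 , _) , _)) = ℤP.<-irrefl refl (subst (⁺ 0 ℤ.<_) (ℤP.+-inverseʳ S) 0<0)
      disjointLeading x (refl , _) (inj₂ ((0<0 , _) , _)) = ℤP.<-irrefl refl (subst (⁺ 0 ℤ.<_) (ℤP.+-inverseʳ S) 0<0)

  p-succ : ∀ n m ℓ → 1 ≤ n →
    p n (suc m) ℓ ≡ δ₀₀ m ℓ + (cumulative p (n ∸ sameGap k) m ℓ + cumulative p (n ∸ oppGap k) ℓ m)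
  p-succ n m ℓ 1≤n = count-unique (p-counts n (suc m) ℓ 1≤n)
    (count-cong (count-decomposed n m ℓ) (λ x → recompose n m ℓ x 1≤n) (decompose n m ℓ))

  p-zero : ∀ n ℓ → 1 ≤ n → p n 0 ℓ ≡ 0
  p-zero n ℓ 1≤n = count-unique (p-counts n 0 ℓ 1≤n) (count-none (block-no-positive n ℓ))

≡ᵇ-refl : ∀ n → (n ≡ᵇ n) ≡ true
≡ᵇ-refl zero    = refl
≡ᵇ-refl (suc n) = ≡ᵇ-refl n

≡ᵇ-≢ : ∀ {m n} → m ≢ n → (m ≡ᵇ n) ≡ false
≡ᵇ-≢ {m} {n} m≢n with m ≡ᵇ n in eq
... | false = refl
... | true  = ⊥-elim (m≢n (≡ᵇ⇒≡ m n (subst T (sym eq) tt)))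

≤ᵇ-true : ∀ {m n} → m ≤ n → (m ≤ᵇ n) ≡ true
≤ᵇ-true m≤n = Equivalence.to BoolP.T-≡ (≤⇒≤ᵇ m≤n)

≤ᵇ-false : ∀ {m n} → n < m → (m ≤ᵇ n) ≡ false
≤ᵇ-false {m} {n} n<m with m ≤ᵇ n in eq
... | false = refl
... | true  = ⊥-elim (<⇒≱ n<m (≤ᵇ⇒≤ m n (subst T (sym eq) tt)))

-- pick b v = v if b holds, 0 otherwise.  A monomial is a product of picks:
-- mono c i j l a b d ≡ pick (a ≡ᵇ i) (pick (b ≡ᵇ j) (pick (d ≡ᵇ l) c)).
pick : Bool → ℤ → ℤ
pick b v = if b then v else ⁺ 0

pick-* : ∀ x b v → x ℤ.* pick b v ≡ pick b (x ℤ.* v)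
pick-* x true  v = refl
pick-* x false v = ℤP.*-zeroʳ x

Σ< : ℕ → (ℕ → ℤ) → ℤ
Σ< zero    f = ⁺ 0
Σ< (suc n) f = f 0 ℤ.+ Σ< n (f ∘ suc)

sumTo≡Σ< : ∀ n f → sumTo n f ≡ Σ< (suc n) f
sumTo≡Σ< n f = sum-applyUpTo (suc n) f (λ i → i)
  where
    sum-applyUpTo : ∀ n (f : ℕ → ℤ) (g : ℕ → ℕ) → sumℤ (map f (applyUpTo g n)) ≡ Σ< n (f ∘ g)
    sum-applyUpTo zero    f g = refl
    sum-applyUpTo (suc n) f g = cong (ℤ._+_ (f (g 0))) (sum-applyUpTo n f (g ∘ suc))

Σ<-cong : ∀ n {f g} → (∀ i → f i ≡ g i) → Σ< n f ≡ Σ< n g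
Σ<-cong zero    f≗g = refl
Σ<-cong (suc n) f≗g = cong₂ ℤ._+_ (f≗g 0) (Σ<-cong n (f≗g ∘ suc))

Σ<-+ : ∀ n f g → Σ< n (λ i → f i ℤ.+ g i) ≡ Σ< n f ℤ.+ Σ< n g
Σ<-+ zero    f g = refl
Σ<-+ (suc n) f g = trans (cong (ℤ._+_ (f 0 ℤ.+ g 0)) (Σ<-+ n (f ∘ suc) (g ∘ suc)))
                         (interchange (f 0) (g 0) (Σ< n (f ∘ suc)) (Σ< n (g ∘ suc)))
  where
    interchange : ∀ a b c d → (a ℤ.+ b) ℤ.+ (c ℤ.+ d) ≡ (a ℤ.+ c) ℤ.+ (b ℤ.+ d)
    interchange = ℤ-Solver.solve-∀

Σ<-pick : ∀ n b f → Σ< n (λ i → pick b (f i)) ≡ pick b (Σ< n f)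
Σ<-pick n true  f = refl
Σ<-pick zero    false f = refl
Σ<-pick (suc n) false f = trans (ℤP.+-identityˡ _) (Σ<-pick n false (f ∘ suc))

-- Only the term with a − i = i₀ survives.
Σ<-delta : ∀ a i₀ (g : ℕ → ℤ) → Σ< (suc a) (λ i → pick (a ∸ i ≡ᵇ i₀) (g i)) ≡ pick (i₀ ≤ᵇ a) (g (a ∸ i₀))
Σ<-delta zero zero      g = ℤP.+-identityʳ (g 0)
Σ<-delta zero (suc i₀)  g = refl
Σ<-delta (suc a) i₀ g = trans (cong (ℤ._+_ (pick (suc a ≡ᵇ i₀) (g 0))) (Σ<-delta a i₀ (g ∘ suc))) (split (<-cmp i₀ (suc a)))
  where
    split : Tri (i₀ < suc a) (i₀ ≡ suc a) (suc a < i₀)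
      → pick (suc a ≡ᵇ i₀) (g 0) ℤ.+ pick (i₀ ≤ᵇ a) (g (suc (a ∸ i₀))) ≡ pick (i₀ ≤ᵇ suc a) (g (suc a ∸ i₀))
    split (tri< (s≤s i₀≤a) _ _)
      rewrite ≡ᵇ-≢ {suc a} {i₀} (λ eq → <-irrefl (sym eq) (s≤s i₀≤a)) | ≤ᵇ-true i₀≤a
            | ≤ᵇ-true (m≤n⇒m≤1+n i₀≤a) | +-∸-assoc 1 i₀≤a = ℤP.+-identityˡ _
    split (tri≈ _ refl _)
      rewrite ≡ᵇ-refl (suc a) | ≤ᵇ-false {suc a} {a} ≤-refl | ≤ᵇ-true (≤-refl {suc a}) | n∸n≡0 a =
        ℤP.+-identityʳ (g 0)
    split (tri> _ _ 1+a<i₀)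
      rewrite ≡ᵇ-≢ {suc a} {i₀} (λ eq → <-irrefl eq 1+a<i₀) | ≤ᵇ-false {i₀} {a} (<-trans (n<1+n a) 1+a<i₀)
            | ≤ᵇ-false 1+a<i₀ = refl

sumTo-cong : ∀ n {f g} → (∀ i → f i ≡ g i) → sumTo n f ≡ sumTo n g
sumTo-cong n {f} {g} f≗g = trans (sumTo≡Σ< n f) (trans (Σ<-cong (suc n) f≗g) (sym (sumTo≡Σ< n g)))

sumTo-+ : ∀ n f g → sumTo n (λ i → f i ℤ.+ g i) ≡ sumTo n f ℤ.+ sumTo n g
sumTo-+ n f g = trans (sumTo≡Σ< n (λ i → f i ℤ.+ g i)) (trans (Σ<-+ (suc n) f g) (sym (cong₂ ℤ._+_ (sumTo≡Σ< n f) (sumTo≡Σ< n g))))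

sumTo-pick : ∀ n b f → sumTo n (λ i → pick b (f i)) ≡ pick b (sumTo n f)
sumTo-pick n b f = trans (sumTo≡Σ< n (λ i → pick b (f i))) (trans (Σ<-pick (suc n) b f) (cong (pick b) (sym (sumTo≡Σ< n f))))

-- Coefficients at integer exponents: at x g = g x for x ≥ 0, and 0 for x < 0.
-- extend f is the coefficient function of the series f on all of ℤ³, so
-- multiplying by a monomial becomes a shift of the exponents.
at : ℤ → (ℕ → ℤ) → ℤ
at (⁺ n)     g = g n
at -[1+ n ] g = ⁺ 0

extend : Series → ℤ → ℤ → ℤ → ℤ
extend f x y z = at x λ a → at y λ b → at z λ c → f a b c

at-cong : ∀ x {g h} → (∀ n → g n ≡ h n) → at x g ≡ at x h
at-cong (⁺ n)     g≗h = g≗h n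
at-cong -[1+ n ] g≗h = refl

at-zero : ∀ x → at x (λ _ → ⁺ 0) ≡ ⁺ 0
at-zero (⁺ n)     = refl
at-zero -[1+ n ] = refl

at-pick : ∀ x b g → at x (λ n → pick b (g n)) ≡ pick b (at x g)
at-pick (⁺ n)     b g = refl
at-pick -[1+ n ] true  g = refl
at-pick -[1+ n ] false g = refl

at-* : ∀ x g v → at x (λ n → g n ℤ.* v) ≡ at x g ℤ.* v
at-* (⁺ n)     g v = refl
at-* -[1+ n ] g v = refl

at-sub : ∀ a i g → at (⁺ a ℤ.- ⁺ i) g ≡ pick (i ≤ᵇ a) (g (a ∸ i))
at-sub a i g with ≤-<-connex i a
... | inj₁ i≤a rewrite ℤP.m-n≡m⊖n a i | ℤP.⊖-≥ i≤a | ≤ᵇ-true i≤a = refl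
... | inj₂ a<i rewrite ℤP.m-n≡m⊖n a i | ℤP.⊖-< a<i | ≤ᵇ-false a<i = at-negative (i ∸ a) (m<n⇒0<n∸m a<i)
  where
    at-negative : ∀ n → 0 < n → at (ℤ.- ⁺ n) g ≡ ⁺ 0
    at-negative (suc n) _ = refl

sumTo-delta : ∀ a i₀ g → sumTo a (λ i → pick (a ∸ i ≡ᵇ i₀) (g i)) ≡ at (⁺ a ℤ.- ⁺ i₀) g
sumTo-delta a i₀ g = trans (sumTo≡Σ< a (λ i → pick (a ∸ i ≡ᵇ i₀) (g i))) (trans (Σ<-delta a i₀ g) (sym (at-sub a i₀ g)))

sum³ : ℕ → ℕ → ℕ → (ℕ → ℕ → ℕ → ℤ) → ℤ
sum³ a b c F = sumTo a λ i → sumTo b λ j → sumTo c λ l → F i j l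

sum³-cong : ∀ a b c {F G} → (∀ i j l → F i j l ≡ G i j l) → sum³ a b c F ≡ sum³ a b c G
sum³-cong a b c F≗G = sumTo-cong a λ i → sumTo-cong b λ j → sumTo-cong c λ l → F≗G i j l

sum³-+ : ∀ a b c F G → sum³ a b c (λ i j l → F i j l ℤ.+ G i j l) ≡ sum³ a b c F ℤ.+ sum³ a b c G
sum³-+ a b c F G =
  trans (sumTo-cong a (λ i → trans (sumTo-cong b (λ j → sumTo-+ c (F i j) (G i j)))
                                   (sumTo-+ b (λ j → sumTo c (F i j)) (λ j → sumTo c (G i j)))))
        (sumTo-+ a (λ i → sumTo b λ j → sumTo c (F i j)) (λ i → sumTo b λ j → sumTo c (G i j)))

sum³-delta : ∀ a b c i₀ j₀ l₀ F →
  sum³ a b c (λ i j l → pick (a ∸ i ≡ᵇ i₀) (pick (b ∸ j ≡ᵇ j₀) (pick (c ∸ l ≡ᵇ l₀) (F i j l))))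
  ≡ extend F (⁺ a ℤ.- ⁺ i₀) (⁺ b ℤ.- ⁺ j₀) (⁺ c ℤ.- ⁺ l₀)
sum³-delta a b c i₀ j₀ l₀ F = trans (sumTo-cong a middle) (sumTo-delta a i₀ _)
  where
    A : ℕ → Bool
    A i = a ∸ i ≡ᵇ i₀
    B : ℕ → Bool
    B j = b ∸ j ≡ᵇ j₀
    inner : ∀ i j → sumTo c (λ l → pick (A i) (pick (B j) (pick (c ∸ l ≡ᵇ l₀) (F i j l))))
                    ≡ pick (A i) (pick (B j) (at (⁺ c ℤ.- ⁺ l₀) (F i j)))
    inner i j = trans (sumTo-pick c (A i) _)
                  (cong (pick (A i)) (trans (sumTo-pick c (B j) _) (cong (pick (B j)) (sumTo-delta c l₀ (F i j)))))
    middle : ∀ i → sumTo b (λ j → sumTo c (λ l → pick (A i) (pick (B j) (pick (c ∸ l ≡ᵇ l₀) (F i j l)))))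
                   ≡ pick (A i) (at (⁺ b ℤ.- ⁺ j₀) (λ j → at (⁺ c ℤ.- ⁺ l₀) (F i j)))
    middle i = trans (sumTo-cong b (inner i))
                 (trans (sumTo-pick b (A i) _) (cong (pick (A i)) (sumTo-delta b j₀ _)))

conv-⊕ : ∀ f g h a b c → (f ⊛ (g ⊕ h)) a b c ≡ (f ⊛ g) a b c ℤ.+ (f ⊛ h) a b c
conv-⊕ f g h a b c =
  trans (sum³-cong a b c λ i j l → ℤP.*-distribˡ-+ (f i j l) (g (a ∸ i) (b ∸ j) (c ∸ l)) (h (a ∸ i) (b ∸ j) (c ∸ l)))
        (sum³-+ a b c (λ i j l → f i j l ℤ.* g (a ∸ i) (b ∸ j) (c ∸ l)) (λ i j l → f i j l ℤ.* h (a ∸ i) (b ∸ j) (c ∸ l)))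

conv-mono : ∀ f coef i₀ j₀ l₀ a b c →
  (f ⊛ mono coef i₀ j₀ l₀) a b c ≡ extend f (⁺ a ℤ.- ⁺ i₀) (⁺ b ℤ.- ⁺ j₀) (⁺ c ℤ.- ⁺ l₀) ℤ.* coef
conv-mono f coef i₀ j₀ l₀ a b c = begin
  (f ⊛ mono coef i₀ j₀ l₀) a b c
    ≡⟨ sum³-cong a b c (λ i j l → mono-factor (f i j l) (a ∸ i ≡ᵇ i₀) (b ∸ j ≡ᵇ j₀) (c ∸ l ≡ᵇ l₀)) ⟩
  sum³ a b c (λ i j l → pick (a ∸ i ≡ᵇ i₀) (pick (b ∸ j ≡ᵇ j₀) (pick (c ∸ l ≡ᵇ l₀) (f i j l ℤ.* coef))))
    ≡⟨ sum³-delta a b c i₀ j₀ l₀ (λ i j l → f i j l ℤ.* coef) ⟩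
  at X (λ i → at Y (λ j → at Z (λ l → f i j l ℤ.* coef)))
    ≡⟨ at-cong X (λ i → trans (at-cong Y (λ j → at-* Z (f i j) coef)) (at-* Y _ coef)) ⟩
  at X (λ i → at Y (λ j → at Z (f i j)) ℤ.* coef)
    ≡⟨ at-* X _ coef ⟩
  extend f X Y Z ℤ.* coef ∎
  where
    open ≡-Reasoning
    X Y Z : ℤ
    X = ⁺ a ℤ.- ⁺ i₀
    Y = ⁺ b ℤ.- ⁺ j₀
    Z = ⁺ c ℤ.- ⁺ l₀
    mono-factor : ∀ v p q r → v ℤ.* pick p (pick q (pick r coef)) ≡ pick p (pick q (pick r (v ℤ.* coef)))
    mono-factor v p q r =
      trans (pick-* v p _) (cong (pick p) (trans (pick-* v q _) (cong (pick q) (pick-* v r coef))))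

at-sub-delta : ∀ a i i′ v → at (⁺ a ℤ.- ⁺ i′) (λ a′ → pick (a′ ≡ᵇ i) v) ≡ pick (a ≡ᵇ i + i′) v
at-sub-delta a i i′ v with ≤-<-connex i′ a
... | inj₁ i′≤a = trans (at-sub a i′ _) (trans (≤ᵇ-pick (≤ᵇ-true i′≤a)) (cong (λ t → pick t v) (shifted-test (a ∸ i′ ℕ.≟ i))))
  where
    ≤ᵇ-pick : ∀ {t} → t ≡ true → pick t (pick (a ∸ i′ ≡ᵇ i) v) ≡ pick (a ∸ i′ ≡ᵇ i) v
    ≤ᵇ-pick refl = refl
    shifted-test : Dec (a ∸ i′ ≡ i) → (a ∸ i′ ≡ᵇ i) ≡ (a ≡ᵇ i + i′)
    shifted-test (yes refl) = trans (≡ᵇ-refl (a ∸ i′)) (sym (subst (λ n → (a ≡ᵇ n) ≡ true) (sym (m∸n+n≡m i′≤a)) (≡ᵇ-refl a)))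
    shifted-test (no a-i′≢i) = trans (≡ᵇ-≢ a-i′≢i) (sym (≡ᵇ-≢ (λ a≡ → a-i′≢i (trans (cong (_∸ i′) a≡) (m+n∸n≡m i i′)))))
... | inj₂ a<i′ = trans (at-sub a i′ _) (trans (cong (λ t → pick t (pick (a ∸ i′ ≡ᵇ i) v)) (≤ᵇ-false a<i′))
                    (cong (λ t → pick t v) (sym (≡ᵇ-≢ (λ a≡ → <⇒≱ a<i′ (subst (i′ ≤_) (sym a≡) (m≤n+m i′ i)))))))

extend-mono : ∀ coef i j l i′ j′ l′ a b c →
  extend (mono coef i j l) (⁺ a ℤ.- ⁺ i′) (⁺ b ℤ.- ⁺ j′) (⁺ c ℤ.- ⁺ l′) ≡ mono coef (i + i′) (j + j′) (l + l′) a b c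
extend-mono coef i j l i′ j′ l′ a b c =
  trans (at-cong (⁺ a ℤ.- ⁺ i′) (λ a′ → trans (at-cong (⁺ b ℤ.- ⁺ j′) (shift-z a′)) (shift-y a′)))
        (at-sub-delta a i i′ _)
  where
    shift-z : ∀ a′ b′ → at (⁺ c ℤ.- ⁺ l′) (λ c′ → mono coef i j l a′ b′ c′)
                        ≡ pick (a′ ≡ᵇ i) (pick (b′ ≡ᵇ j) (pick (c ≡ᵇ l + l′) coef))
    shift-z a′ b′ = trans (at-pick (⁺ c ℤ.- ⁺ l′) (a′ ≡ᵇ i) _)
      (cong (pick (a′ ≡ᵇ i)) (trans (at-pick (⁺ c ℤ.- ⁺ l′) (b′ ≡ᵇ j) _) (cong (pick (b′ ≡ᵇ j)) (at-sub-delta c l l′ coef))))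
    shift-y : ∀ a′ → at (⁺ b ℤ.- ⁺ j′) (λ b′ → pick (a′ ≡ᵇ i) (pick (b′ ≡ᵇ j) (pick (c ≡ᵇ l + l′) coef)))
                     ≡ pick (a′ ≡ᵇ i) (pick (b ≡ᵇ j + j′) (pick (c ≡ᵇ l + l′) coef))
    shift-y a′ = trans (at-pick (⁺ b ℤ.- ⁺ j′) (a′ ≡ᵇ i) _) (cong (pick (a′ ≡ᵇ i)) (at-sub-delta b j j′ _))

pick-zero : ∀ b → pick b (⁺ 0) ≡ ⁺ 0
pick-zero true  = refl
pick-zero false = refl

-- For coefficient sequences vanishing at 0 the boundary test is unnecessary.
at-sub-vanishing : ∀ c l (g : ℕ → ℤ) → g 0 ≡ ⁺ 0 → at (⁺ c ℤ.- ⁺ l) g ≡ g (c ∸ l)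
at-sub-vanishing c l g g0≡0 with ≤-<-connex l c
... | inj₁ l≤c = trans (at-sub c l g) (cong (λ t → pick t (g (c ∸ l))) (≤ᵇ-true l≤c))
... | inj₂ c<l = trans (at-sub c l g) (trans (cong (λ t → pick t (g (c ∸ l))) (≤ᵇ-false c<l))
                   (sym (trans (cong g (m≤n⇒m∸n≡0 (<⇒≤ c<l))) g0≡0)))

at-negative-sub : ∀ c l g → at (-[1+ c ] ℤ.- ⁺ l) g ≡ ⁺ 0
at-negative-sub c zero    g = refl
at-negative-sub c (suc l) g = refl

-- The denominator 1 − 2z + z² − (x+y)z^{κ₂} + (x+y)z^{κ₂+1} − xy z^{2κ₁} + xy z^{2κ₂}
-- (κ₁ = k+2, κ₂ = 2k+2) acting on a coefficient function E on ℤ³, and the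
-- numerator xz − xz² + xy z^{κ₁+1} − xy z^{κ₂+1} written via the coefficients Δ of xz.
denominatorAction : (ℤ → ℤ → ℤ → ℤ) → ℤ → ℤ → ℤ → ℤ → ℤ → ℤ
denominatorAction E κ₁ κ₂ x y z =
  E x y z ℤ.* ⁺ 1 ℤ.+ E x y (z ℤ.- ⁺ 1) ℤ.* ℤ.- ⁺ 2 ℤ.+ E x y ((z ℤ.- ⁺ 1) ℤ.- ⁺ 1) ℤ.* ⁺ 1
  ℤ.+ E (x ℤ.- ⁺ 1) y (z ℤ.- κ₂) ℤ.* ℤ.- ⁺ 1 ℤ.+ E x (y ℤ.- ⁺ 1) (z ℤ.- κ₂) ℤ.* ℤ.- ⁺ 1
  ℤ.+ E (x ℤ.- ⁺ 1) y ((z ℤ.- ⁺ 1) ℤ.- κ₂) ℤ.* ⁺ 1 ℤ.+ E x (y ℤ.- ⁺ 1) ((z ℤ.- ⁺ 1) ℤ.- κ₂) ℤ.* ⁺ 1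
  ℤ.+ E (x ℤ.- ⁺ 1) (y ℤ.- ⁺ 1) ((z ℤ.- κ₁) ℤ.- κ₁) ℤ.* ℤ.- ⁺ 1
  ℤ.+ E (x ℤ.- ⁺ 1) (y ℤ.- ⁺ 1) ((z ℤ.- κ₂) ℤ.- κ₂) ℤ.* ⁺ 1

numeratorAction : (ℤ → ℤ → ℤ → ℤ) → ℤ → ℤ → ℤ → ℤ → ℤ → ℤ
numeratorAction Δ κ₁ κ₂ x y z =
  Δ x y z ℤ.- Δ x y (z ℤ.- ⁺ 1) ℤ.+ Δ y (x ℤ.- ⁺ 1) (z ℤ.- κ₁) ℤ.- Δ x (y ℤ.- ⁺ 1) (z ℤ.- κ₂)

-- Suppose E(x,y,z) = E(x,y,z−1) + E(x−1,y,z−κ₂) + Δ(x,y,z) + E(y,x−1,z−κ₁)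
-- on all of ℤ³, i.e. (1 − z − x z^{κ₂}) G(x,y) = Δ + x z^{κ₁} G(y,x).  Applying
-- the recurrence at (x,y,z), (x,y,z−1), (x,y−1,z−κ₂) and (y,x−1,z−κ₁)
-- eliminates the swapped series G(y,x): the denominator applied to E equals
-- the numerator expressed through Δ.
denominator-eliminates : ∀ (E Δ : ℤ → ℤ → ℤ → ℤ) κ₁ κ₂
  → (∀ x y z → E x y z ≡ E x y (z ℤ.- ⁺ 1) ℤ.+ E (x ℤ.- ⁺ 1) y (z ℤ.- κ₂) ℤ.+ Δ x y z ℤ.+ E y (x ℤ.- ⁺ 1) (z ℤ.- κ₁))
  → ∀ x y z → denominatorAction E κ₁ κ₂ x y z ≡ numeratorAction Δ κ₁ κ₂ x y z
denominator-eliminates E Δ κ₁ κ₂ rec x y z =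
  substitute (E x y z) (E x y z₁) (E x y (z₁ ℤ.- ⁺ 1)) (E x₁ y (z ℤ.- κ₂)) (E x y₁ (z ℤ.- κ₂))
    (E x₁ y (z₁ ℤ.- κ₂)) (E x y₁ (z₁ ℤ.- κ₂)) (E x₁ y₁ ((z ℤ.- κ₁) ℤ.- κ₁)) (E x₁ y₁ ((z ℤ.- κ₂) ℤ.- κ₂))
    (E y x₁ (z ℤ.- κ₁)) (E y x₁ (z₁ ℤ.- κ₁)) (E y₁ x₁ ((z ℤ.- κ₂) ℤ.- κ₁))
    (Δ x y z) (Δ x y z₁) (Δ x y₁ (z ℤ.- κ₂)) (Δ y x₁ (z ℤ.- κ₁))
    (rec x y z) (rec x y z₁)
    (trans (rec x y₁ (z ℤ.- κ₂))
      (cong (λ w → E x y₁ w ℤ.+ E x₁ y₁ ((z ℤ.- κ₂) ℤ.- κ₂) ℤ.+ Δ x y₁ (z ℤ.- κ₂) ℤ.+ E y₁ x₁ ((z ℤ.- κ₂) ℤ.- κ₁))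
        (swap z κ₂ (⁺ 1))))
    (trans (rec y x₁ (z ℤ.- κ₁))
      (cong₂ (λ w w′ → E y x₁ w ℤ.+ E y₁ x₁ w′ ℤ.+ Δ y x₁ (z ℤ.- κ₁) ℤ.+ E x₁ y₁ ((z ℤ.- κ₁) ℤ.- κ₁))
        (swap z κ₁ (⁺ 1)) (swap z κ₁ κ₂)))
  where
    x₁ y₁ z₁ : ℤ
    x₁ = x ℤ.- ⁺ 1
    y₁ = y ℤ.- ⁺ 1
    z₁ = z ℤ.- ⁺ 1
    swap : ∀ z u v → (z ℤ.- u) ℤ.- v ≡ (z ℤ.- v) ℤ.- u
    swap = ℤ-Solver.solve-∀
    -- Once the four instances are substituted, the identity is a ring identity.
    cancellation : ∀ e₂ e₃ e₅ e₆ e₇ e₈ s₂ s₃ d₁ d₂ d₃ d₄ →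
      ((e₂ ℤ.+ e₅ ℤ.+ d₂ ℤ.+ s₂) ℤ.+ e₃ ℤ.+ d₁ ℤ.+ (s₂ ℤ.+ s₃ ℤ.+ d₄ ℤ.+ e₇)) ℤ.* ⁺ 1
      ℤ.+ (e₂ ℤ.+ e₅ ℤ.+ d₂ ℤ.+ s₂) ℤ.* ℤ.- ⁺ 2 ℤ.+ e₂ ℤ.* ⁺ 1 ℤ.+ e₃ ℤ.* ℤ.- ⁺ 1
      ℤ.+ (e₆ ℤ.+ e₈ ℤ.+ d₃ ℤ.+ s₃) ℤ.* ℤ.- ⁺ 1 ℤ.+ e₅ ℤ.* ⁺ 1 ℤ.+ e₆ ℤ.* ⁺ 1 ℤ.+ e₇ ℤ.* ℤ.- ⁺ 1 ℤ.+ e₈ ℤ.* ⁺ 1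
      ≡ d₁ ℤ.- d₂ ℤ.+ d₄ ℤ.- d₃
    cancellation = ℤ-Solver.solve-∀
    substitute : ∀ e₀ e₁ e₂ e₃ e₄ e₅ e₆ e₇ e₈ s₁ s₂ s₃ d₁ d₂ d₃ d₄ →
      e₀ ≡ e₁ ℤ.+ e₃ ℤ.+ d₁ ℤ.+ s₁ → e₁ ≡ e₂ ℤ.+ e₅ ℤ.+ d₂ ℤ.+ s₂ →
      e₄ ≡ e₆ ℤ.+ e₈ ℤ.+ d₃ ℤ.+ s₃ → s₁ ≡ s₂ ℤ.+ s₃ ℤ.+ d₄ ℤ.+ e₇ →
      e₀ ℤ.* ⁺ 1 ℤ.+ e₁ ℤ.* ℤ.- ⁺ 2 ℤ.+ e₂ ℤ.* ⁺ 1 ℤ.+ e₃ ℤ.* ℤ.- ⁺ 1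
      ℤ.+ e₄ ℤ.* ℤ.- ⁺ 1 ℤ.+ e₅ ℤ.* ⁺ 1 ℤ.+ e₆ ℤ.* ⁺ 1 ℤ.+ e₇ ℤ.* ℤ.- ⁺ 1 ℤ.+ e₈ ℤ.* ⁺ 1
      ≡ d₁ ℤ.- d₂ ℤ.+ d₄ ℤ.- d₃
    substitute ._ ._ e₂ e₃ ._ e₅ e₆ e₇ e₈ ._ s₂ s₃ d₁ d₂ d₃ d₄ refl refl refl refl =
      cancellation e₂ e₃ e₅ e₆ e₇ e₈ s₂ s₃ d₁ d₂ d₃ d₄

-- The series xz, the inhomogeneous term of the recursion.
xz : Series
xz = mono (⁺ 1) 1 0 1

module CoefficientRecurrence (k : ℕ) (p : ℕ → ℕ → ℕ → ℕ)
  (p-counts : ∀ n m ℓ → 1 ≤ n → IsCount (λ x → InBlock k n x × HasRep k m ℓ x) (p n m ℓ)) where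
  open BlockCounts k p p-counts

  G : Series
  G = GenFun p

  cumulative-step : ∀ K → 1 ≤ K → ∀ n m ℓ →
    ⁺ cumulative p (suc n ∸ K) m ℓ ≡ ⁺ cumulative p (n ∸ K) m ℓ ℤ.+ G m ℓ (suc n ∸ K)
  cumulative-step (suc K) _ n m ℓ with ≤-<-connex n K
  ... | inj₁ n≤K rewrite m≤n⇒m∸n≡0 n≤K | m≤n⇒m∸n≡0 (m≤n⇒m≤1+n n≤K) = refl
  ... | inj₂ K<n rewrite +-∸-assoc 1 K<n = refl

  G-no-positive : ∀ b c → G 0 b c ≡ ⁺ 0
  G-no-positive b zero    = refl
  G-no-positive b (suc c) = cong ⁺_ (p-zero (suc c) b (s≤s z≤n))

  G-recurrenceℕ : ∀ a b c → G (suc a) b c ≡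
    G (suc a) b (c ∸ 1) ℤ.+ G a b (c ∸ sameGap k) ℤ.+ xz (suc a) b c ℤ.+ G b a (c ∸ oppGap k)
  G-recurrenceℕ a b zero = sym (begin
    ⁺ 0 ℤ.+ G a b (0 ∸ sameGap k) ℤ.+ xz (suc a) b 0 ℤ.+ G b a (0 ∸ oppGap k)
      ≡⟨ cong₂ (λ u v → ⁺ 0 ℤ.+ G a b u ℤ.+ xz (suc a) b 0 ℤ.+ G b a v) (0∸n≡0 (sameGap k)) (0∸n≡0 (oppGap k)) ⟩
    ⁺ 0 ℤ.+ xz (suc a) b 0 ℤ.+ ⁺ 0
      ≡⟨ cong (λ t → ⁺ 0 ℤ.+ t ℤ.+ ⁺ 0) (trans (cong (pick (a ≡ᵇ 0)) (pick-zero (b ≡ᵇ 0))) (pick-zero (a ≡ᵇ 0))) ⟩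
    ⁺ 0 ∎)
    where open ≡-Reasoning
  G-recurrenceℕ a b (suc zero) = begin
    ⁺ p 1 (suc a) b
      ≡⟨ cong ⁺_ (p-succ 1 a b (s≤s z≤n)) ⟩
    ⁺ δ₀₀ a b ℤ.+ (⁺ cumulative p (1 ∸ sameGap k) a b ℤ.+ ⁺ cumulative p (1 ∸ oppGap k) b a)
      ≡⟨ cong₂ (λ u v → ⁺ δ₀₀ a b ℤ.+ (⁺ cumulative p u a b ℤ.+ ⁺ cumulative p v b a))
               (m≤n⇒m∸n≡0 (1≤sameGap k)) (m≤n⇒m∸n≡0 (1≤oppGap k)) ⟩
    ⁺ δ₀₀ a b ℤ.+ ⁺ 0
      ≡⟨ initial a b ⟩
    ⁺ 0 ℤ.+ G a b 0 ℤ.+ xz (suc a) b 1 ℤ.+ G b a 0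
      ≡⟨ cong₂ (λ u v → ⁺ 0 ℤ.+ G a b u ℤ.+ xz (suc a) b 1 ℤ.+ G b a v)
               (sym (m≤n⇒m∸n≡0 (1≤sameGap k))) (sym (m≤n⇒m∸n≡0 (1≤oppGap k))) ⟩
    G (suc a) b 0 ℤ.+ G a b (1 ∸ sameGap k) ℤ.+ xz (suc a) b 1 ℤ.+ G b a (1 ∸ oppGap k) ∎
    where
      open ≡-Reasoning
      initial : ∀ a b → ⁺ δ₀₀ a b ℤ.+ ⁺ 0 ≡ ⁺ 0 ℤ.+ G a b 0 ℤ.+ xz (suc a) b 1 ℤ.+ G b a 0
      initial zero    zero    = refl
      initial zero    (suc b) = refl
      initial (suc a) b       = refl
  G-recurrenceℕ a b (suc (suc n)) = begin
    ⁺ p (suc (suc n)) (suc a) b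
      ≡⟨ cong ⁺_ (p-succ (suc (suc n)) a b (s≤s z≤n)) ⟩
    ⁺ δ₀₀ a b ℤ.+ (⁺ C₂′ ℤ.+ ⁺ C₁′)
      ≡⟨ cong (λ t → ⁺ δ₀₀ a b ℤ.+ t) (cong₂ ℤ._+_ (cumulative-step (sameGap k) (1≤sameGap k) (suc n) a b)
                                                   (cumulative-step (oppGap k) (1≤oppGap k) (suc n) b a)) ⟩
    ⁺ δ₀₀ a b ℤ.+ ((⁺ C₂ ℤ.+ g₂) ℤ.+ (⁺ C₁ ℤ.+ g₁))
      ≡⟨ regroup (⁺ δ₀₀ a b) (⁺ C₂) (⁺ C₁) g₂ g₁ ⟩
    ⁺ δ₀₀ a b ℤ.+ (⁺ C₂ ℤ.+ ⁺ C₁) ℤ.+ g₂ ℤ.+ ⁺ 0 ℤ.+ g₁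
      ≡⟨ sym (cong₂ (λ u v → u ℤ.+ g₂ ℤ.+ v ℤ.+ g₁) (cong ⁺_ (p-succ (suc n) a b (s≤s z≤n))) xz-vanishes) ⟩
    G (suc a) b (suc n) ℤ.+ g₂ ℤ.+ xz (suc a) b (suc (suc n)) ℤ.+ g₁ ∎
    where
      open ≡-Reasoning
      C₂ C₁ C₂′ C₁′ : ℕ
      C₂  = cumulative p (suc n ∸ sameGap k) a b
      C₁  = cumulative p (suc n ∸ oppGap k) b a
      C₂′ = cumulative p (suc (suc n) ∸ sameGap k) a b
      C₁′ = cumulative p (suc (suc n) ∸ oppGap k) b a
      g₂ g₁ : ℤ
      g₂ = G a b (suc (suc n) ∸ sameGap k)
      g₁ = G b a (suc (suc n) ∸ oppGap k)
      xz-vanishes : xz (suc a) b (suc (suc n)) ≡ ⁺ 0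
      xz-vanishes = trans (cong (pick (a ≡ᵇ 0)) (pick-zero (b ≡ᵇ 0))) (pick-zero (a ≡ᵇ 0))
      regroup : ∀ d c₂ c₁ g₂ g₁ → d ℤ.+ ((c₂ ℤ.+ g₂) ℤ.+ (c₁ ℤ.+ g₁)) ≡ d ℤ.+ (c₂ ℤ.+ c₁) ℤ.+ g₂ ℤ.+ ⁺ 0 ℤ.+ g₁
      regroup = ℤ-Solver.solve-∀

  E Δ : ℤ → ℤ → ℤ → ℤ
  E = extend G
  Δ = extend xz

  κ₁ κ₂ : ℤ
  κ₁ = ⁺ oppGap k
  κ₂ = ⁺ sameGap k

  G-recurrence : ∀ x y z →
    E x y z ≡ E x y (z ℤ.- ⁺ 1) ℤ.+ E (x ℤ.- ⁺ 1) y (z ℤ.- κ₂) ℤ.+ Δ x y z ℤ.+ E y (x ℤ.- ⁺ 1) (z ℤ.- κ₁)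
  -- Outside ℕ³ both sides vanish; on ℕ³ it is G-recurrenceℕ (or 0 = 0 when a = 0).
  G-recurrence -[1+ a ] y z rewrite at-zero y = refl
  G-recurrence (⁺ a) -[1+ b ] z rewrite at-zero (⁺ a ℤ.- ⁺ 1) = refl
  G-recurrence (⁺ a) (⁺ b) -[1+ c ] =
    sym (cong₂ (λ u v → ⁺ 0 ℤ.+ u ℤ.+ ⁺ 0 ℤ.+ v)
      (trans (at-cong (⁺ a ℤ.- ⁺ 1) (λ a′ → at-negative-sub c (sameGap k) (G a′ b))) (at-zero (⁺ a ℤ.- ⁺ 1)))
      (trans (at-cong (⁺ a ℤ.- ⁺ 1) (λ a′ → at-negative-sub c (oppGap k) (G b a′))) (at-zero (⁺ a ℤ.- ⁺ 1))))
  G-recurrence (⁺ a) (⁺ b) (⁺ c) = begin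
    G a b c
      ≡⟨ recurrence a ⟩
    G a b (c ∸ 1) ℤ.+ pick (1 ≤ᵇ a) (G (a ∸ 1) b (c ∸ sameGap k)) ℤ.+ xz a b c
      ℤ.+ pick (1 ≤ᵇ a) (G b (a ∸ 1) (c ∸ oppGap k))
      ≡⟨ sym (cong₂ (λ u v → u ℤ.+ v ℤ.+ xz a b c ℤ.+ pick (1 ≤ᵇ a) (G b (a ∸ 1) (c ∸ oppGap k)))
                    (at-sub-vanishing c 1 (G a b) refl) (shifted (sameGap k) (λ a′ → G a′ b) (λ _ → refl))) ⟩
    E (⁺ a) (⁺ b) (⁺ c ℤ.- ⁺ 1) ℤ.+ E (⁺ a ℤ.- ⁺ 1) (⁺ b) (⁺ c ℤ.- κ₂) ℤ.+ xz a b c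
      ℤ.+ pick (1 ≤ᵇ a) (G b (a ∸ 1) (c ∸ oppGap k))
      ≡⟨ sym (cong (λ v → E (⁺ a) (⁺ b) (⁺ c ℤ.- ⁺ 1) ℤ.+ E (⁺ a ℤ.- ⁺ 1) (⁺ b) (⁺ c ℤ.- κ₂) ℤ.+ xz a b c ℤ.+ v)
                   (shifted (oppGap k) (G b) (λ _ → refl))) ⟩
    E (⁺ a) (⁺ b) (⁺ c ℤ.- ⁺ 1) ℤ.+ E (⁺ a ℤ.- ⁺ 1) (⁺ b) (⁺ c ℤ.- κ₂) ℤ.+ Δ (⁺ a) (⁺ b) (⁺ c)
      ℤ.+ E (⁺ b) (⁺ a ℤ.- ⁺ 1) (⁺ c ℤ.- κ₁) ∎
    where
      open ≡-Reasoning
      shifted : ∀ K (H : ℕ → ℕ → ℤ) → (∀ a′ → H a′ 0 ≡ ⁺ 0)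
        → at (⁺ a ℤ.- ⁺ 1) (λ a′ → at (⁺ c ℤ.- ⁺ K) (H a′)) ≡ pick (1 ≤ᵇ a) (H (a ∸ 1) (c ∸ K))
      shifted K H H0 = trans (at-cong (⁺ a ℤ.- ⁺ 1) (λ a′ → at-sub-vanishing c K (H a′) (H0 a′)))
                             (at-sub a 1 (λ a′ → H a′ (c ∸ K)))
      recurrence : ∀ a → G a b c ≡ G a b (c ∸ 1) ℤ.+ pick (1 ≤ᵇ a) (G (a ∸ 1) b (c ∸ sameGap k)) ℤ.+ xz a b c
                                     ℤ.+ pick (1 ≤ᵇ a) (G b (a ∸ 1) (c ∸ oppGap k))
      recurrence zero    = trans (G-no-positive b c)
                                 (sym (cong (λ g → g ℤ.+ ⁺ 0 ℤ.+ ⁺ 0 ℤ.+ ⁺ 0) (G-no-positive b (c ∸ 1))))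
      recurrence (suc a) = G-recurrenceℕ a b c

conv-foldl : ∀ f g hs a b c →
  (f ⊛ foldl _⊕_ g hs) a b c ≡ foldl (λ acc h → acc ℤ.+ (f ⊛ h) a b c) ((f ⊛ g) a b c) hs
conv-foldl f g []       a b c = refl
conv-foldl f g (h ∷ hs) a b c =
  trans (conv-foldl f (g ⊕ h) hs a b c)
        (cong (λ s → foldl (λ acc h → acc ℤ.+ (f ⊛ h) a b c) s hs) (conv-⊕ f g h a b c))

sub-split : ∀ z m n {l} → l ≡ m + n → z ℤ.- ⁺ l ≡ (z ℤ.- ⁺ m) ℤ.- ⁺ n
sub-split z m n refl = trans (cong (λ t → z ℤ.- t) (ℤP.pos-+ m n)) (sub-sub z (⁺ m) (⁺ n))
  where
    sub-sub : ∀ z u v → z ℤ.- (u ℤ.+ v) ≡ (z ℤ.- u) ℤ.- v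
    sub-sub = ℤ-Solver.solve-∀

sub-zero : ∀ a → ⁺ a ℤ.- ⁺ 0 ≡ ⁺ a
sub-zero a = ℤP.+-identityʳ (⁺ a)

conv-Den : ∀ k f a b c →
  (f ⊛ Den k) a b c ≡ denominatorAction (extend f) (⁺ oppGap k) (⁺ sameGap k) (⁺ a) (⁺ b) (⁺ c)
conv-Den k f a b c =
  trans (conv-foldl f (mono (⁺ 1) 0 0 0) tail-monomials a b c)
    (cong-sum₉
      (shift (⁺ 1) 0 0 0 (sub-zero a) (sub-zero b) (sub-zero c))
      (shift (ℤ.- ⁺ 2) 0 0 1 (sub-zero a) (sub-zero b) refl)
      (shift (⁺ 1) 0 0 2 (sub-zero a) (sub-zero b) (sub-split (⁺ c) 1 1 refl))
      (shift (ℤ.- ⁺ 1) 1 0 (sameGap k) refl (sub-zero b) refl)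
      (shift (ℤ.- ⁺ 1) 0 1 (sameGap k) (sub-zero a) refl refl)
      (shift (⁺ 1) 1 0 (2 * k + 3) refl (sub-zero b) (sub-split (⁺ c) 1 (sameGap k) (3+2k k)))
      (shift (⁺ 1) 0 1 (2 * k + 3) (sub-zero a) refl (sub-split (⁺ c) 1 (sameGap k) (3+2k k)))
      (shift (ℤ.- ⁺ 1) 1 1 (2 * k + 4) refl refl (sub-split (⁺ c) (oppGap k) (oppGap k) (4+2k k)))
      (shift (⁺ 1) 1 1 (4 * k + 4) refl refl (sub-split (⁺ c) (sameGap k) (sameGap k) (4+4k k))))
  where
    tail-monomials : List Series
    tail-monomials =
      mono (ℤ.- ⁺ 2) 0 0 1 ∷ mono (⁺ 1) 0 0 2
      ∷ mono (ℤ.- ⁺ 1) 1 0 (2 * k + 2) ∷ mono (ℤ.- ⁺ 1) 0 1 (2 * k + 2)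
      ∷ mono (⁺ 1) 1 0 (2 * k + 3) ∷ mono (⁺ 1) 0 1 (2 * k + 3)
      ∷ mono (ℤ.- ⁺ 1) 1 1 (2 * k + 4) ∷ mono (⁺ 1) 1 1 (4 * k + 4) ∷ []
    shift : ∀ coef i j l {x y z} → ⁺ a ℤ.- ⁺ i ≡ x → ⁺ b ℤ.- ⁺ j ≡ y → ⁺ c ℤ.- ⁺ l ≡ z
      → (f ⊛ mono coef i j l) a b c ≡ extend f x y z ℤ.* coef
    shift coef i j l refl refl refl = conv-mono f coef i j l a b c
    cong-sum₉ : ∀ {u₁ u₂ u₃ u₄ u₅ u₆ u₇ u₈ u₉ v₁ v₂ v₃ v₄ v₅ v₆ v₇ v₈ v₉ : ℤ} →
      u₁ ≡ v₁ → u₂ ≡ v₂ → u₃ ≡ v₃ → u₄ ≡ v₄ → u₅ ≡ v₅ → u₆ ≡ v₆ → u₇ ≡ v₇ → u₈ ≡ v₈ → u₉ ≡ v₉ →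
      u₁ ℤ.+ u₂ ℤ.+ u₃ ℤ.+ u₄ ℤ.+ u₅ ℤ.+ u₆ ℤ.+ u₇ ℤ.+ u₈ ℤ.+ u₉
      ≡ v₁ ℤ.+ v₂ ℤ.+ v₃ ℤ.+ v₄ ℤ.+ v₅ ℤ.+ v₆ ℤ.+ v₇ ℤ.+ v₈ ℤ.+ v₉
    cong-sum₉ refl refl refl refl refl refl refl refl refl = refl
    3+2k : ∀ k → 2 * k + 3 ≡ 1 + (2 * k + 2)
    3+2k = solve-∀
    4+2k : ∀ k → 2 * k + 4 ≡ (k + 2) + (k + 2)
    4+2k = solve-∀
    4+4k : ∀ k → 4 * k + 4 ≡ (2 * k + 2) + (2 * k + 2)
    4+4k = solve-∀

pick-neg : ∀ b v → ℤ.- pick b v ≡ pick b (ℤ.- v)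
pick-neg true  v = refl
pick-neg false v = refl

mono-neg : ∀ i j l a b c → ℤ.- mono (⁺ 1) i j l a b c ≡ mono (ℤ.- ⁺ 1) i j l a b c
mono-neg i j l a b c =
  trans (pick-neg (a ≡ᵇ i) _) (cong (pick (a ≡ᵇ i)) (trans (pick-neg (b ≡ᵇ j) _) (cong (pick (b ≡ᵇ j)) (pick-neg (c ≡ᵇ l) _))))

mono-xy-swap : ∀ coef l a b c → mono coef 1 1 l b a c ≡ mono coef 1 1 l a b c
mono-xy-swap coef l a b c with a ≡ᵇ 1 | b ≡ᵇ 1
... | true  | true  = refl
... | true  | false = refl
... | false | true  = refl
... | false | false = refl

Num-from-xz : ∀ k a b c →
  numeratorAction (extend xz) (⁺ oppGap k) (⁺ sameGap k) (⁺ a) (⁺ b) (⁺ c) ≡ Num k a b c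
Num-from-xz k a b c = cong-sum₄ {u₁ = xz a b c} refl z²-term xyz-term xyz²-term
  where
    cong-sum₄ : ∀ {u₁ u₂ u₃ u₄ v₁ v₂ v₃ v₄ : ℤ} → u₁ ≡ v₁ → u₂ ≡ v₂ → u₃ ≡ v₃ → u₄ ≡ v₄ →
      u₁ ℤ.+ u₂ ℤ.+ u₃ ℤ.+ u₄ ≡ v₁ ℤ.+ v₂ ℤ.+ v₃ ℤ.+ v₄
    cong-sum₄ refl refl refl refl = refl
    z²-term : ℤ.- extend xz (⁺ a) (⁺ b) (⁺ c ℤ.- ⁺ 1) ≡ mono (ℤ.- ⁺ 1) 1 0 2 a b c
    z²-term = trans (cong ℤ.-_ (trans (cong₂ (λ x y → extend xz x y (⁺ c ℤ.- ⁺ 1)) (sym (sub-zero a)) (sym (sub-zero b)))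
                                      (extend-mono (⁺ 1) 1 0 1 0 0 1 a b c)))
                    (mono-neg 1 0 2 a b c)
    xyz-term : extend xz (⁺ b) (⁺ a ℤ.- ⁺ 1) (⁺ c ℤ.- ⁺ oppGap k) ≡ mono (⁺ 1) 1 1 (k + 3) a b c
    xyz-term = begin
      extend xz (⁺ b) (⁺ a ℤ.- ⁺ 1) (⁺ c ℤ.- ⁺ oppGap k)
        ≡⟨ cong (λ x → extend xz x (⁺ a ℤ.- ⁺ 1) (⁺ c ℤ.- ⁺ oppGap k)) (sym (sub-zero b)) ⟩
      extend xz (⁺ b ℤ.- ⁺ 0) (⁺ a ℤ.- ⁺ 1) (⁺ c ℤ.- ⁺ oppGap k)
        ≡⟨ extend-mono (⁺ 1) 1 0 1 0 1 (oppGap k) b a c ⟩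
      mono (⁺ 1) 1 1 (1 + oppGap k) b a c
        ≡⟨ mono-xy-swap (⁺ 1) (1 + oppGap k) a b c ⟩
      mono (⁺ 1) 1 1 (1 + oppGap k) a b c
        ≡⟨ cong (λ l → mono (⁺ 1) 1 1 l a b c) (3+k k) ⟩
      mono (⁺ 1) 1 1 (k + 3) a b c ∎
      where
        open ≡-Reasoning
        3+k : ∀ k → 1 + (k + 2) ≡ k + 3
        3+k = solve-∀
    xyz²-term : ℤ.- extend xz (⁺ a) (⁺ b ℤ.- ⁺ 1) (⁺ c ℤ.- ⁺ sameGap k) ≡ mono (ℤ.- ⁺ 1) 1 1 (2 * k + 3) a b c
    xyz²-term = begin
      ℤ.- extend xz (⁺ a) (⁺ b ℤ.- ⁺ 1) (⁺ c ℤ.- ⁺ sameGap k)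
        ≡⟨ cong (λ x → ℤ.- extend xz x (⁺ b ℤ.- ⁺ 1) (⁺ c ℤ.- ⁺ sameGap k)) (sym (sub-zero a)) ⟩
      ℤ.- extend xz (⁺ a ℤ.- ⁺ 0) (⁺ b ℤ.- ⁺ 1) (⁺ c ℤ.- ⁺ sameGap k)
        ≡⟨ cong ℤ.-_ (extend-mono (⁺ 1) 1 0 1 0 1 (sameGap k) a b c) ⟩
      ℤ.- mono (⁺ 1) 1 1 (1 + sameGap k) a b c
        ≡⟨ mono-neg 1 1 (1 + sameGap k) a b c ⟩
      mono (ℤ.- ⁺ 1) 1 1 (1 + sameGap k) a b c
        ≡⟨ cong (λ l → mono (ℤ.- ⁺ 1) 1 1 l a b c) (3+2k k) ⟩
      mono (ℤ.- ⁺ 1) 1 1 (2 * k + 3) a b c ∎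
      where
        open ≡-Reasoning
        3+2k : ∀ k → 1 + (2 * k + 2) ≡ 2 * k + 3
        3+2k = solve-∀

theorem3p2 : (k : ℕ) → 1 ≤ k → (p : ℕ → ℕ → ℕ → ℕ)
    → (∀ n m ℓ → 1 ≤ n → IsCount (λ x → InBlock k n x × HasRep k m ℓ x) (p n m ℓ))
    → ∀ a b c → (GenFun p ⊛ Den k) a b c ≡ Num k a b c
theorem3p2 k _ p p-counts a b c = begin
  (GenFun p ⊛ Den k) a b c
    ≡⟨ conv-Den k (GenFun p) a b c ⟩
  denominatorAction E κ₁ κ₂ (⁺ a) (⁺ b) (⁺ c)
    ≡⟨ denominator-eliminates E Δ κ₁ κ₂ G-recurrence (⁺ a) (⁺ b) (⁺ c) ⟩
  numeratorAction Δ κ₁ κ₂ (⁺ a) (⁺ b) (⁺ c)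
    ≡⟨ Num-from-xz k a b c ⟩
  Num k a b c ∎
  where
    open ≡-Reasoning
    open CoefficientRecurrence k p p-counts
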